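{- Let $d\ge 2$ be an integer. For $n\ge1$, let $y_n$ be the number of partitions of a convex $(n+d+1)$-gon (with distinguishable vertices) made by noncrossing diagonals (any number of them, including none, with no restriction on the shapes of the parts) such that one of the parts is a $(d+1)$-gon having a fixed side of the polygon as one of its sides. Then \[ y_n = \frac{d}{n+d}\sum_{k=1}^n\binom{n+k+d-1}{k}\binom{n-1}{k-1}. \] -}

module Defs where

open import Data.Nat using (ℕ; zero; suc; _+_; _*_; _∸_; _≡ᵇ_; _<ᵇ_)
open import Data.Nat.Combinatorics using (_C_)
open import Data.Bool using (Bool; true; false; _∧_; _∨_; not; if_then_else_)
open import Data.List using (List; []; _∷_; map; filterᵇ; length; upTo; concatMap; _++_)
open import Data.Nat.ListAction using (sum)
open import Data.Bool.ListAction using (all; any)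
open import Data.Product using (_×_; _,_)

-- Vertices of a convex N-gon are labelled 0,1,…,N-1 in cyclic order
-- (distinguishable vertices).  The sides are {i,i+1} and {0,N-1};
-- the fixed side is {0,N-1}.

Pair : Set
Pair = ℕ × ℕ

isDiagonal : ℕ → Pair → Bool
isDiagonal N (i , j) =
  (i <ᵇ j) ∧ (1 <ᵇ (j ∸ i)) ∧ (j <ᵇ N) ∧ not ((i ≡ᵇ 0) ∧ (j ≡ᵇ (N ∸ 1)))

diagonals : ℕ → List Pair
diagonals N = filterᵇ (isDiagonal N)
  (concatMap (λ i → map (λ j → (i , j)) (upTo N)) (upTo N))

-- All sublists (= all subsets, since `diagonals N` has no duplicates).
sublists : {A : Set} → List A → List (List A)
sublists []       = [] ∷ []
sublists (x ∷ xs) = let r = sublists xs in r ++ map (x ∷_) r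

crosses : Pair → Pair → Bool
crosses (a , b) (c , e) =
  ((a <ᵇ c) ∧ (c <ᵇ b) ∧ (b <ᵇ e)) ∨ ((c <ᵇ a) ∧ (a <ᵇ e) ∧ (e <ᵇ b))

noncrossing : List Pair → Bool
noncrossing []       = true
noncrossing (x ∷ xs) = all (λ y → not (crosses x y)) xs ∧ noncrossing xs

-- Vertex v is separated from the fixed side {0,N-1} by diagonal (a , b)
-- iff a < v < b.
separates : ℕ → Pair → Bool
separates v (a , b) = (a <ᵇ v) ∧ (v <ᵇ b)

-- Number of vertices (= number of sides) of the part of the dissection
-- having the fixed side {0,N-1} as a side: the vertices not separated
-- from that side by any diagonal of the dissection.
fixedPartSize : ℕ → List Pair → ℕ
fixedPartSize N ds =
  length (filterᵇ (λ v → not (any (separates v) ds)) (upTo N))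

dissections : ℕ → List (List Pair)
dissections N = filterᵇ noncrossing (sublists (diagonals N))

y : ℕ → ℕ → ℕ
y d n = length (filterᵇ (λ ds → fixedPartSize (n + d + 1) ds ≡ᵇ (d + 1))
                        (dissections (n + d + 1)))

rhsSum : ℕ → ℕ → ℕ
rhsSum d n = sum (map (λ k → ((n + k + d ∸ 1) C k) * ((n ∸ 1) C (k ∸ 1)))
                      (map suc (upTo n)))

-- Call the root part of a dissection of the polygon a, a+1, …, a+m the part containing the side (a , a+m), and let
-- g a m r count the dissections whose root part has r + 1 vertices; with (a , a+m) itself allowed as a chord,
-- g a m 1 counts all dissections of the polygon. Cutting a dissection at its root vertices turns g
-- into a convolution, and cutting at the first root vertex after a gives the recurrence
--   g a (n+e+1) (e+1) = g (a+1) (n+e) e + Σ_{i<n} g a (n+e+1) (e+2+i).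
-- By absorption identities for binomial coefficients, d Σ_k C(n+k+d-1, k) C(n-1, k-1) / (n+d) satisfies the same
-- recurrence and initial values, so strong induction on n identifies (n+d) y_n with it.

module Submission where

open import Data.Bool using (Bool; true; false; _∧_; not; T; if_then_else_)
open import Data.Bool.ListAction using (all; any)
open import Data.Bool.Properties using (T-∨; ∧-zeroʳ; ∧-identityʳ; ∧-comm; not-involutive)
open import Data.Empty using (⊥; ⊥-elim)
open import Data.List using (List; []; _∷_; _++_; map; length; filterᵇ; null; concatMap; upTo; applyUpTo; cartesianProduct)
open import Data.List.Membership.Propositional using (_∈_; find; lose)
open import Data.List.Membership.Propositional.Properties using (∈-filter⁺; ∈-filter⁻; ∈-cartesianProduct⁺; ∈-upTo⁺)
open import Data.List.Properties using (length-++; length-map; filter-++; filter-none)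
open import Data.List.Relation.Unary.All using (All; []; _∷_; universal; tabulate) renaming (lookup to All-lookup)
import Data.List.Relation.Unary.All as All
open import Data.List.Relation.Unary.All.Properties using (all⁺; all⁻; all-filter)
open import Data.List.Relation.Unary.Any using (here; there)
open import Data.List.Relation.Unary.Any.Properties using (any⁺; any⁻)
open import Data.List.Relation.Unary.Unique.Propositional using (Unique; _∷_)
import Data.List.Relation.Unary.Unique.Propositional.Properties as Unique
open import Data.Nat
open import Data.Nat.Combinatorics using (_C_; nCk+nC[k+1]≡[n+1]C[k+1])
open import Data.Nat.Induction using (<-rec)
open import Data.Nat.ListAction using (sum)
open import Data.Nat.Properties
open import Data.Nat.Tactic.RingSolver using (solve-∀)
open import Data.Product using (_×_; _,_; proj₁; proj₂; ∃)
open import Data.Sum using (_⊎_; inj₁; inj₂; [_,_]′)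
import Data.Sum
open import Data.Unit using (⊤; tt)
open import Function using (_∘_; id; Equivalence)
open import Relation.Binary.PropositionalEquality
open import Relation.Nullary using (¬_; yes; no)
open import Relation.Nullary.Decidable using (T?)
open import Defs

∑< : ℕ → (ℕ → ℕ) → ℕ
∑< zero    f = 0
∑< (suc n) f = f 0 + ∑< n (λ i → f (suc i))

syntax ∑< n (λ i → e) = ∑[ i < n ] e

∑<-cong : ∀ n {f g : ℕ → ℕ} → (∀ i → i < n → f i ≡ g i) → ∑< n f ≡ ∑< n g
∑<-cong zero    eq = refl
∑<-cong (suc n) eq = cong₂ _+_ (eq 0 z<s) (∑<-cong n (λ i i<n → eq (suc i) (s<s i<n)))

∑<-0 : ∀ n → ∑[ i < n ] 0 ≡ 0
∑<-0 zero    = refl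
∑<-0 (suc n) = ∑<-0 n

∑<-zero : ∀ n (f : ℕ → ℕ) → (∀ i → f i ≡ 0) → ∑< n f ≡ 0
∑<-zero n f f≡0 = trans (∑<-cong n (λ i _ → f≡0 i)) (∑<-0 n)

∑<-distrib-+ : ∀ n (f g : ℕ → ℕ) → ∑[ i < n ] (f i + g i) ≡ ∑< n f + ∑< n g
∑<-distrib-+ zero    f g = refl
∑<-distrib-+ (suc n) f g = begin
  f 0 + g 0 + ∑[ i < n ] (f (suc i) + g (suc i))  ≡⟨ cong (f 0 + g 0 +_) (∑<-distrib-+ n _ _) ⟩
  f 0 + g 0 + (∑<f + ∑<g)                          ≡⟨ +-+-comm (f 0) (g 0) ∑<f ∑<g ⟩
  f 0 + ∑<f + (g 0 + ∑<g)                          ∎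
  where
  open ≡-Reasoning
  ∑<f = ∑[ i < n ] f (suc i)
  ∑<g = ∑[ i < n ] g (suc i)
  +-+-comm : ∀ a b c d → a + b + (c + d) ≡ a + c + (b + d)
  +-+-comm = solve-∀

∑<-*ˡ : ∀ n a (f : ℕ → ℕ) → ∑[ i < n ] (a * f i) ≡ a * ∑< n f
∑<-*ˡ zero    a f = sym (*-zeroʳ a)
∑<-*ˡ (suc n) a f = trans (cong (a * f 0 +_) (∑<-*ˡ n a _)) (sym (*-distribˡ-+ a (f 0) _))

∑<-*ʳ : ∀ n a (f : ℕ → ℕ) → ∑[ i < n ] (f i * a) ≡ ∑< n f * a
∑<-*ʳ n a f = trans (∑<-cong n (λ i _ → *-comm (f i) a)) (trans (∑<-*ˡ n a f) (*-comm a _))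

∑<-suc : ∀ n (f : ℕ → ℕ) → ∑< (suc n) f ≡ ∑< n f + f n
∑<-suc zero    f = +-comm (f 0) 0
∑<-suc (suc n) f = trans (cong (f 0 +_) (∑<-suc n _)) (sym (+-assoc (f 0) _ _))

∑<-+ : ∀ m n (f : ℕ → ℕ) → ∑< (m + n) f ≡ ∑< m f + ∑[ i < n ] f (m + i)
∑<-+ zero    n f = refl
∑<-+ (suc m) n f = trans (cong (f 0 +_) (∑<-+ m n _)) (sym (+-assoc (f 0) _ _))

∑<-vanishing : ∀ m n (f : ℕ → ℕ) → (∀ i → m ≤ i → f i ≡ 0) → ∑< (m + n) f ≡ ∑< m f
∑<-vanishing m n f f≡0 = begin
  ∑< (m + n) f                   ≡⟨ ∑<-+ m n f ⟩
  ∑< m f + ∑[ i < n ] f (m + i)  ≡⟨ cong (∑< m f +_) (∑<-zero n _ (λ i → f≡0 (m + i) (m≤m+n m i))) ⟩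
  ∑< m f + 0                     ≡⟨ +-identityʳ _ ⟩
  ∑< m f                         ∎
  where open ≡-Reasoning

∑<-comm : ∀ m n (f : ℕ → ℕ → ℕ) → ∑[ i < m ] ∑[ j < n ] f i j ≡ ∑[ j < n ] ∑[ i < m ] f i j
∑<-comm zero    n f = sym (∑<-0 n)
∑<-comm (suc m) n f = trans (cong (∑[ j < n ] f 0 j +_) (∑<-comm m n (λ i → f (suc i))))
                            (sym (∑<-distrib-+ n (f 0) _))

∑<-≡0⇒≡0 : ∀ n (f : ℕ → ℕ) → ∑< n f ≡ 0 → ∀ i → i < n → f i ≡ 0
∑<-≡0⇒≡0 (suc n) f sum≡0 zero    _         = m+n≡0⇒m≡0 (f 0) sum≡0
∑<-≡0⇒≡0 (suc n) f sum≡0 (suc i) (s≤s i<n) = ∑<-≡0⇒≡0 n _ (m+n≡0⇒n≡0 (f 0) sum≡0) i i<n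

-- Binomial coefficients

-- Pascal's rule as the definition; the library's _C_ is defined by division.
infix 5 _choose_

_choose_ : ℕ → ℕ → ℕ
n     choose zero  = 1
zero  choose suc k = 0
suc n choose suc k = (n choose k) + (n choose suc k)

C≡choose : ∀ n k → n C k ≡ n choose k
C≡choose n       zero    = refl
C≡choose zero    (suc k) = refl
C≡choose (suc n) (suc k) = trans (sym (nCk+nC[k+1]≡[n+1]C[k+1] n k))
                                 (cong₂ _+_ (C≡choose n k) (C≡choose n (suc k)))

choose-< : ∀ {n k} → n < k → n choose k ≡ 0
choose-< {zero}  {suc k} _         = refl
choose-< {suc n} {suc k} (s≤s n<k) = cong₂ _+_ (choose-< n<k) (choose-< (m<n⇒m<1+n n<k))

choose-1 : ∀ n → n choose 1 ≡ n
choose-1 zero    = refl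
choose-1 (suc n) = cong suc (choose-1 n)

choose-absorb : ∀ n k → suc k * (suc n choose suc k) ≡ suc n * (n choose k)
choose-absorb n       zero    = trans (*-identityˡ _) (trans (choose-1 (suc n)) (sym (*-identityʳ _)))
choose-absorb zero    (suc k) = *-zeroʳ (suc (suc k))
choose-absorb (suc n) (suc k) = begin
  suc (suc k) * (a + b)                          ≡⟨ split (suc k) a b ⟩
  suc k * a + a + suc (suc k) * b                ≡⟨ cong₂ (λ x y → x + a + y) (choose-absorb n k) (choose-absorb n (suc k)) ⟩
  suc n * c + (c + c′) + suc n * c′              ≡⟨ merge n c c′ ⟩
  suc (suc n) * (c + c′)                         ∎
  where
  open ≡-Reasoning
  a = suc n choose suc k
  b = suc n choose suc (suc k)
  c = n choose k
  c′ = n choose suc k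
  split : ∀ k a b → suc k * (a + b) ≡ k * a + a + suc k * b
  split = solve-∀
  merge : ∀ n c c′ → suc n * c + (c + c′) + suc n * c′ ≡ suc (suc n) * (c + c′)
  merge = solve-∀

choose-suc : ∀ t k → suc k * (k + t choose suc k) ≡ t * (k + t choose k)
choose-suc t k = +-cancelʳ-≡ (suc k * c) _ _ (begin
  suc k * c′ + suc k * c              ≡⟨ +-comm (suc k * c′) _ ⟩
  suc k * c + suc k * c′              ≡⟨ *-distribˡ-+ (suc k) c c′ ⟨
  suc k * (suc (k + t) choose suc k)  ≡⟨ choose-absorb (k + t) k ⟩
  suc (k + t) * c                     ≡⟨ split k t c ⟩
  t * c + suc k * c                   ∎)
  where
  open ≡-Reasoning
  c = k + t choose k
  c′ = k + t choose suc k
  split : ∀ k t c → suc (k + t) * c ≡ t * c + suc k * c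
  split = solve-∀

-- The closed form and its recurrence

rhsTerm : ℕ → ℕ → ℕ → ℕ
rhsTerm d zero    zero    = d
rhsTerm d zero    (suc k) = 0
rhsTerm d (suc n) zero    = 0
rhsTerm d (suc n) (suc k) = d * (suc n + d + k choose suc k) * (n choose k)

-- rhs d n is (n + d) y_n: rhsTerm d (suc p) k is the summand of index k + 1 of the theorem, and
-- rhs d 0 = d corresponds to the single undissected (d + 1)-gon.
rhs : ℕ → ℕ → ℕ
rhs d n = ∑< (suc n) (rhsTerm d n)

rhs≡d*rhsSum : ∀ d p → rhs d (suc p) ≡ d * rhsSum d (suc p)
rhs≡d*rhsSum d p = begin
    ∑[ k < suc p ] (d * (suc p + d + k choose suc k) * (p choose k))
  ≡⟨ ∑<-cong (suc p) (λ k _ → trans (*-assoc d (suc p + d + k choose suc k) (p choose k)) (cong (λ z → d * ((z choose suc k) * (p choose k))) (reindex p k d))) ⟩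
    ∑[ k < suc p ] (d * ((p + suc k + d choose suc k) * (p choose k)))
  ≡⟨ ∑<-*ˡ (suc p) d (λ k → (p + suc k + d choose suc k) * (p choose k)) ⟩
    d * ∑[ k < suc p ] ((p + suc k + d choose suc k) * (p choose k))
  ≡⟨ cong (d *_) (∑<-cong (suc p) (λ k _ → sym (cong₂ _*_ (C≡choose (p + suc k + d) (suc k)) (C≡choose p k)))) ⟩
    d * ∑[ k < suc p ] (((p + suc k + d) C suc k) * (p C k))
  ≡⟨ cong (d *_) (sym (sum-map (suc p) (λ k → ((suc p + k + d ∸ 1) C k) * ((suc p ∸ 1) C (k ∸ 1))) (λ i → i))) ⟩
    d * rhsSum d (suc p)
  ∎
  where
  open ≡-Reasoning
  reindex : ∀ p k d → suc p + d + k ≡ p + suc k + d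
  reindex = solve-∀
  sum-map : ∀ n (f h : ℕ → ℕ) → sum (map f (map suc (applyUpTo h n))) ≡ ∑[ k < n ] f (suc (h k))
  sum-map zero    f h = refl
  sum-map (suc n) f h = cong (f (suc (h 0)) +_) (sum-map n f (λ i → h (suc i)))

shift : (ℕ → ℕ) → ℕ → ℕ
shift f zero    = 0
shift f (suc k) = f k

TermContiguity : ℕ → ℕ → ℕ → Set
TermContiguity e n k =
  (n + suc e) * rhsTerm (suc e) (suc n) k + suc (n + suc e) * rhsTerm (suc e) n k
  ≡ suc (n + suc e) * rhsTerm e (suc n) k + (n + suc e) * rhsTerm (suc (suc e)) n k
    + (n + suc e) * shift (rhsTerm (suc (suc e)) n) k

-- By absorption, the binomials α, β, γ, δ of TermContiguity e (suc (q + t)) (suc (suc q)) are rational multiples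
-- of X or Y; after clearing the denominators q + 2 and q + 1 the recurrence becomes a polynomial identity.
module _ (q t e α β γ δ X Y : ℕ)
  (α≈ : suc (suc q) * α ≡ suc (suc (suc (q + t + suc e + q))) * X)
  (β≈ : suc (suc q) * β ≡ suc (q + t + suc e) * X)
  (γ≈ : suc q * γ ≡ suc (q + t) * Y)
  (δ≈ : suc q * δ ≡ t * Y) where

  private
    m = suc (q + t) + suc e
    c = suc (suc q) * suc q

  ratio-identity : m * (suc e * α * γ) + suc m * (suc e * β * δ)
                 ≡ suc m * (e * β * γ) + m * (suc (suc e) * α * δ) + m * (suc (suc e) * X * Y)
  ratio-identity = *-cancelˡ-≡ _ _ c (begin
      c * (m * (suc e * α * γ) + suc m * (suc e * β * δ))
    ≡⟨ expandˡ q m (suc e) α β γ δ ⟩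
      m * suc e * (suc (suc q) * α) * (suc q * γ) + suc m * suc e * (suc (suc q) * β) * (suc q * δ)
    ≡⟨ cong₂ (λ u v → m * suc e * u * (suc q * γ) + suc m * suc e * v * (suc q * δ)) α≈ β≈ ⟩
      m * suc e * (A * X) * (suc q * γ) + suc m * suc e * (B * X) * (suc q * δ)
    ≡⟨ cong₂ (λ u v → m * suc e * (A * X) * u + suc m * suc e * (B * X) * v) γ≈ δ≈ ⟩
      m * suc e * (A * X) * (suc (q + t) * Y) + suc m * suc e * (B * X) * (t * Y)
    ≡⟨ polynomial q t e X Y ⟩
      suc m * e * (B * X) * (suc (q + t) * Y) + m * suc (suc e) * (A * X) * (t * Y) + m * suc (suc e) * X * Y * c
    ≡⟨ cong₂ (λ u v → suc m * e * u * (suc (q + t) * Y) + m * suc (suc e) * v * (t * Y) + m * suc (suc e) * X * Y * c) (sym β≈) (sym α≈) ⟩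
      suc m * e * (suc (suc q) * β) * (suc (q + t) * Y) + m * suc (suc e) * (suc (suc q) * α) * (t * Y) + m * suc (suc e) * X * Y * c
    ≡⟨ cong₂ (λ u v → suc m * e * (suc (suc q) * β) * u + m * suc (suc e) * (suc (suc q) * α) * v + m * suc (suc e) * X * Y * c) (sym γ≈) (sym δ≈) ⟩
      suc m * e * (suc (suc q) * β) * (suc q * γ) + m * suc (suc e) * (suc (suc q) * α) * (suc q * δ) + m * suc (suc e) * X * Y * c
    ≡⟨ sym (expandʳ q m e α β γ δ X Y) ⟩
      c * (suc m * (e * β * γ) + m * (suc (suc e) * α * δ) + m * (suc (suc e) * X * Y))
    ∎)
    where
    open ≡-Reasoning
    A = suc (suc (suc (q + t + suc e + q)))
    B = suc (q + t + suc e)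
    expandˡ : ∀ q m d α β γ δ → (suc (suc q) * suc q) * (m * (d * α * γ) + suc m * (d * β * δ))
            ≡ m * d * (suc (suc q) * α) * (suc q * γ) + suc m * d * (suc (suc q) * β) * (suc q * δ)
    expandˡ = solve-∀
    expandʳ : ∀ q m e α β γ δ X Y → (suc (suc q) * suc q) * (suc m * (e * β * γ) + m * (suc (suc e) * α * δ) + m * (suc (suc e) * X * Y))
            ≡ suc m * e * (suc (suc q) * β) * (suc q * γ) + m * suc (suc e) * (suc (suc q) * α) * (suc q * δ)
              + m * suc (suc e) * X * Y * (suc (suc q) * suc q)
    expandʳ = solve-∀
    polynomial : ∀ q t e X Y →
        (suc (q + t) + suc e) * suc e * (suc (suc (suc (q + t + suc e + q))) * X) * (suc (q + t) * Y)
        + suc (suc (q + t) + suc e) * suc e * (suc (q + t + suc e) * X) * (t * Y)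
        ≡ suc (suc (q + t) + suc e) * e * (suc (q + t + suc e) * X) * (suc (q + t) * Y)
        + (suc (q + t) + suc e) * suc (suc e) * (suc (suc (suc (q + t + suc e + q))) * X) * (t * Y)
        + (suc (q + t) + suc e) * suc (suc e) * X * Y * (suc (suc q) * suc q)
    polynomial = solve-∀

termContiguity-generic : ∀ e q t → TermContiguity e (suc (q + t)) (suc (suc q))
termContiguity-generic e q t = begin
    m * (d * α * γ) + suc m * (d * β * δ)
  ≡⟨ ratio-identity q t e α β γ δ X Y α≈ β≈ γ≈ δ≈ ⟩
    suc m * (e * β * γ) + m * (suc d * α * δ) + m * (suc d * X * Y)
  ≡⟨ cong₂ (λ u v → suc m * (e * (u choose suc (suc q)) * γ) + m * (suc d * (v choose suc (suc q)) * δ) + m * (suc d * X * Y))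
           (reindexβ p e q) (reindexα p e q) ⟩
    suc m * (e * (suc (suc p) + e + suc q choose suc (suc q)) * γ) + m * (suc d * (suc p + suc d + suc q choose suc (suc q)) * δ)
      + m * (suc d * X * Y)
  ∎
  where
  open ≡-Reasoning
  p = q + t
  d = suc e
  m = suc p + d
  ν = suc p + suc d + q
  α = suc (suc p) + d + suc q choose suc (suc q)
  β = suc p + d + suc q choose suc (suc q)
  γ = suc p choose suc q
  δ = p choose suc q
  X = ν choose suc q
  Y = p choose q
  reindexα : ∀ p e q → suc (suc p) + suc e + suc q ≡ suc p + suc (suc e) + suc q
  reindexα = solve-∀
  reindexβ : ∀ p e q → suc p + suc e + suc q ≡ suc (suc p) + e + suc q
  reindexβ = solve-∀
  α≈ : suc (suc q) * α ≡ suc (suc (suc (q + t + suc e + q))) * X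
  α≈ = begin
    suc (suc q) * α                           ≡⟨ cong (λ z → suc (suc q) * (z choose suc (suc q))) (idx p e q) ⟩
    suc (suc q) * (suc ν choose suc (suc q))  ≡⟨ choose-absorb ν (suc q) ⟩
    suc ν * X                                 ≡⟨ cong (_* X) (idx′ q t e) ⟩
    suc (suc (suc (q + t + suc e + q))) * X   ∎
    where
    idx : ∀ p e q → suc (suc p) + suc e + suc q ≡ suc (suc p + suc (suc e) + q)
    idx = solve-∀
    idx′ : ∀ q t e → suc (suc (q + t) + suc (suc e) + q) ≡ suc (suc (suc (q + t + suc e + q)))
    idx′ = solve-∀
  β≈ : suc (suc q) * β ≡ suc (q + t + suc e) * X
  β≈ = begin
      suc (suc q) * β
    ≡⟨ cong (λ z → suc (suc q) * (z choose suc (suc q))) (idx p e q) ⟩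
      suc (suc q) * (suc q + suc (q + t + suc e) choose suc (suc q))
    ≡⟨ choose-suc (suc (q + t + suc e)) (suc q) ⟩
      suc (q + t + suc e) * (suc q + suc (q + t + suc e) choose suc q)
    ≡⟨ cong (λ z → suc (q + t + suc e) * (z choose suc q)) (idx′ q t e) ⟩
      suc (q + t + suc e) * X
    ∎
    where
    idx : ∀ p e q → suc p + suc e + suc q ≡ suc q + suc (p + suc e)
    idx = solve-∀
    idx′ : ∀ q t e → suc q + suc (q + t + suc e) ≡ suc (q + t) + suc (suc e) + q
    idx′ = solve-∀
  γ≈ : suc q * γ ≡ suc (q + t) * Y
  γ≈ = choose-absorb p q
  δ≈ : suc q * δ ≡ t * Y
  δ≈ = choose-suc t q

termContiguity : ∀ e n k → TermContiguity e n k
termContiguity e zero zero = poly e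
  where
  poly : ∀ e → (0 + suc e) * 0 + suc (0 + suc e) * suc e
             ≡ suc (0 + suc e) * 0 + (0 + suc e) * suc (suc e) + (0 + suc e) * 0
  poly = solve-∀
termContiguity e zero (suc zero) = poly e _ _ (choose-1 (1 + suc e + 0)) (choose-1 (1 + e + 0))
  where
  poly : ∀ e b b′ → b ≡ 1 + suc e + 0 → b′ ≡ 1 + e + 0 →
         (0 + suc e) * (suc e * b * 1) + suc (0 + suc e) * 0
         ≡ suc (0 + suc e) * (e * b′ * 1) + (0 + suc e) * 0 + (0 + suc e) * suc (suc e)
  poly e _ _ refl refl = polynomial e
    where
    polynomial : ∀ e → (0 + suc e) * (suc e * (1 + suc e + 0) * 1) + suc (0 + suc e) * 0
                     ≡ suc (0 + suc e) * (e * (1 + e + 0) * 1) + (0 + suc e) * 0 + (0 + suc e) * suc (suc e)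
    polynomial = solve-∀
termContiguity e zero (suc (suc k)) =
  poly e (1 + suc e + suc k choose suc (suc k)) (1 + e + suc k choose suc (suc k))
  where
  poly : ∀ e a b → (0 + suc e) * (suc e * a * 0) + suc (0 + suc e) * 0
                 ≡ suc (0 + suc e) * (e * b * 0) + (0 + suc e) * 0 + (0 + suc e) * 0
  poly = solve-∀
termContiguity e (suc p) zero = poly e p
  where
  poly : ∀ e p → (suc p + suc e) * 0 + suc (suc p + suc e) * 0
               ≡ suc (suc p + suc e) * 0 + (suc p + suc e) * 0 + (suc p + suc e) * 0
  poly = solve-∀
termContiguity e (suc p) (suc zero) =
  poly e p _ _ _ _ (choose-1 (suc (suc p) + suc e + 0)) (choose-1 (suc p + suc e + 0))
                   (choose-1 (suc (suc p) + e + 0)) (choose-1 (suc p + suc (suc e) + 0))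
  where
  poly : ∀ e p b₁ b₂ b₃ b₄ → b₁ ≡ suc (suc p) + suc e + 0 → b₂ ≡ suc p + suc e + 0
         → b₃ ≡ suc (suc p) + e + 0 → b₄ ≡ suc p + suc (suc e) + 0 →
         (suc p + suc e) * (suc e * b₁ * 1) + suc (suc p + suc e) * (suc e * b₂ * 1)
         ≡ suc (suc p + suc e) * (e * b₃ * 1) + (suc p + suc e) * (suc (suc e) * b₄ * 1) + (suc p + suc e) * 0
  poly e p _ _ _ _ refl refl refl refl = polynomial e p
    where
    polynomial : ∀ e p → (suc p + suc e) * (suc e * (suc (suc p) + suc e + 0) * 1) + suc (suc p + suc e) * (suc e * (suc p + suc e + 0) * 1)
                       ≡ suc (suc p + suc e) * (e * (suc (suc p) + e + 0) * 1) + (suc p + suc e) * (suc (suc e) * (suc p + suc (suc e) + 0) * 1)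
                         + (suc p + suc e) * 0
    polynomial = solve-∀
termContiguity e (suc p) (suc (suc q)) with q ≤? p
... | yes q≤p = subst (λ n → TermContiguity e (suc n) (suc (suc q))) (m+[n∸m]≡n q≤p) (termContiguity-generic e q (p ∸ q))
... | no q≰p
  rewrite choose-< (s≤s (≰⇒> q≰p)) | choose-< (m<n⇒m<1+n (≰⇒> q≰p)) | choose-< {p} {q} (≰⇒> q≰p) = poly e p (suc (suc p) + suc e + suc q choose suc (suc q)) (suc p + suc e + suc q choose suc (suc q))
             (suc (suc p) + e + suc q choose suc (suc q)) (suc p + suc (suc e) + suc q choose suc (suc q))
             (suc p + suc (suc e) + q choose suc q)
  where
  poly : ∀ e p a b c c′ x → (suc p + suc e) * (suc e * a * 0) + suc (suc p + suc e) * (suc e * b * 0)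
                          ≡ suc (suc p + suc e) * (e * c * 0) + (suc p + suc e) * (suc (suc e) * c′ * 0) + (suc p + suc e) * (suc (suc e) * x * 0)
  poly = solve-∀

rhsTerm-beyond : ∀ d n → rhsTerm d n (suc n) ≡ 0
rhsTerm-beyond d zero    = refl
rhsTerm-beyond d (suc n) = trans (cong (d * (suc n + d + suc n choose suc (suc n)) *_) (choose-< (n<1+n n)))
                                 (*-zeroʳ (d * (suc n + d + suc n choose suc (suc n))))

rhs-extend : ∀ d n → ∑< (suc (suc n)) (rhsTerm d n) ≡ rhs d n
rhs-extend d n = trans (∑<-suc (suc n) (rhsTerm d n)) (trans (cong (rhs d n +_) (rhsTerm-beyond d n)) (+-identityʳ _))

rhsTerm-0 : ∀ n k → rhsTerm 0 n k ≡ 0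
rhsTerm-0 zero    zero    = refl
rhsTerm-0 zero    (suc k) = refl
rhsTerm-0 (suc n) zero    = refl
rhsTerm-0 (suc n) (suc k) = refl

rhs-0 : ∀ n → rhs 0 n ≡ 0
rhs-0 n = ∑<-zero (suc n) (rhsTerm 0 n) (rhsTerm-0 n)

rhs-contiguity : ∀ e n →
  (n + suc e) * rhs (suc e) (suc n) + suc (n + suc e) * rhs (suc e) n
  ≡ suc (n + suc e) * rhs e (suc n) + (n + suc e) * rhs (suc (suc e)) n + (n + suc e) * rhs (suc (suc e)) n
rhs-contiguity e n = begin
    a * rhs (suc e) (suc n) + b * rhs (suc e) n
  ≡⟨ cong (λ z → a * rhs (suc e) (suc n) + b * z) (sym (rhs-extend (suc e) n)) ⟩
    a * ∑< M (rhsTerm (suc e) (suc n)) + b * ∑< M (rhsTerm (suc e) n)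
  ≡⟨ sym (linear M a b (rhsTerm (suc e) (suc n)) (rhsTerm (suc e) n)) ⟩
    ∑[ k < M ] (a * rhsTerm (suc e) (suc n) k + b * rhsTerm (suc e) n k)
  ≡⟨ ∑<-cong M (λ k _ → termContiguity e n k) ⟩
    ∑[ k < M ] (b * rhsTerm e (suc n) k + a * rhsTerm (suc (suc e)) n k + a * shift (rhsTerm (suc (suc e)) n) k)
  ≡⟨ ∑<-distrib-+ M (λ k → b * rhsTerm e (suc n) k + a * rhsTerm (suc (suc e)) n k) (λ k → a * shift (rhsTerm (suc (suc e)) n) k) ⟩
    ∑[ k < M ] (b * rhsTerm e (suc n) k + a * rhsTerm (suc (suc e)) n k) + ∑[ k < M ] (a * shift (rhsTerm (suc (suc e)) n) k)
  ≡⟨ cong₂ _+_ (linear M b a (rhsTerm e (suc n)) (rhsTerm (suc (suc e)) n)) (∑<-*ˡ M a (shift (rhsTerm (suc (suc e)) n))) ⟩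
    b * rhs e (suc n) + a * ∑< M (rhsTerm (suc (suc e)) n) + a * rhs (suc (suc e)) n
  ≡⟨ cong (λ z → b * rhs e (suc n) + a * z + a * rhs (suc (suc e)) n) (rhs-extend (suc (suc e)) n) ⟩
    b * rhs e (suc n) + a * rhs (suc (suc e)) n + a * rhs (suc (suc e)) n
  ∎
  where
  open ≡-Reasoning
  a = n + suc e
  b = suc a
  M = suc (suc n)
  linear : ∀ n a b (f g : ℕ → ℕ) → ∑[ i < n ] (a * f i + b * g i) ≡ a * ∑< n f + b * ∑< n g
  linear n a b f g = trans (∑<-distrib-+ n _ _) (cong₂ _+_ (∑<-*ˡ n a f) (∑<-*ˡ n b g))

-- The recurrence g-recurrence below for g a (n + d) d = rhs d n / (n + d), multiplied by (n + e) (n + e + 1).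
rhs-recurrence : ∀ n e → (n + e) * rhs (suc e) n
               ≡ (n + suc e) * rhs e n + (n + e) * ∑[ i < n ] rhs (suc (suc e) + i) (n ∸ suc i)
rhs-recurrence zero    e = poly e
  where
  poly : ∀ e → e * (suc e + 0) ≡ suc e * (e + 0) + e * 0
  poly = solve-∀
rhs-recurrence (suc n) e = begin
    (suc n + e) * rhs (suc e) (suc n)
  ≡⟨ cong (_* rhs (suc e) (suc n)) (sym (+-suc n e)) ⟩
    a * rhs (suc e) (suc n)
  ≡⟨ eliminate a _ _ _ _ _ (rhs-contiguity e n) (trans ih (cong (λ c → c * rhs (suc e) n + a * S) (+-suc n (suc e)))) ⟩
    suc a * rhs e (suc n) + a * (rhs (suc (suc e)) n + S)
  ≡⟨ cong₂ (λ u v → suc a * rhs e (suc n) + u * (rhs v n + S)) (+-suc n e) (sym (+-identityʳ (suc (suc e)))) ⟩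
    (suc n + suc e) * rhs e (suc n) + (suc n + e) * ∑[ i < suc n ] rhs (suc (suc e) + i) (suc n ∸ suc i)
  ∎
  where
  open ≡-Reasoning
  a = n + suc e
  S = ∑[ i < n ] rhs (suc (suc e) + suc i) (n ∸ suc i)
  ih : a * rhs (suc (suc e)) n ≡ (n + suc (suc e)) * rhs (suc e) n + a * S
  ih = trans (rhs-recurrence n (suc e))
             (cong (λ z → (n + suc (suc e)) * rhs (suc e) n + a * z)
                   (∑<-cong n (λ i _ → cong (λ r → rhs r (n ∸ suc i)) (sym (+-suc (suc (suc e)) i)))))
  eliminate : ∀ a x y z w s → a * x + suc a * y ≡ suc a * z + a * w + a * w → a * w ≡ suc a * y + a * s
            → a * x ≡ suc a * z + a * (w + s)
  eliminate a x y z w s h₁ h₂ = +-cancelʳ-≡ (suc a * y) _ _ (trans h₁ (trans (cong (suc a * z + a * w +_) h₂) (poly a y z w s)))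
    where
    poly : ∀ a y z w s → suc a * z + a * w + (suc a * y + a * s) ≡ suc a * z + a * (w + s) + suc a * y
    poly = solve-∀

module RecurrenceSolution (N : ℕ) (g : ℕ → ℕ → ℕ → ℕ)
  (g-one : ∀ a → g a 0 0 ≡ 1)
  (g-suc-0 : ∀ a m → g a (suc m) 0 ≡ 0)
  (g-recurrence : ∀ a n e → a + (n + suc e) < N →
     g a (n + suc e) (suc e) ≡ g (suc a) (n + e) e + ∑[ i < n ] g a (n + suc e) (suc (suc e) + i))
  where

  Solves : ℕ → Set
  Solves n = ∀ d a → a + (n + d) < N → (n + d) * g a (n + d) d ≡ rhs d n

  private
    solves-0 : ∀ n a → (n + 0) * g a (n + 0) 0 ≡ rhs 0 n
    solves-0 zero    a = refl
    solves-0 (suc n) a = begin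
      (suc n + 0) * g a (suc n + 0) 0  ≡⟨ cong (λ m → m * g a m 0) (+-identityʳ (suc n)) ⟩
      suc n * g a (suc n) 0            ≡⟨ cong (suc n *_) (g-suc-0 a n) ⟩
      suc n * 0                        ≡⟨ *-zeroʳ (suc n) ⟩
      0                                ≡⟨ rhs-0 (suc n) ⟨
      rhs 0 (suc n)                    ∎
      where open ≡-Reasoning

    split-index : ∀ n e i → i < n → (n ∸ suc i) + (suc (suc e) + i) ≡ n + suc e
    split-index (suc n) e zero    _         = trans (+-suc n (suc e + 0)) (cong (λ z → suc (n + suc z)) (+-identityʳ e))
    split-index (suc n) e (suc i) (s≤s i<n) = begin
      n ∸ suc i + (suc (suc e) + suc i)  ≡⟨ cong (n ∸ suc i +_) (+-suc (suc (suc e)) i) ⟩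
      n ∸ suc i + suc (suc (suc e) + i)  ≡⟨ +-suc (n ∸ suc i) (suc (suc e) + i) ⟩
      suc (n ∸ suc i + (suc (suc e) + i)) ≡⟨ cong suc (split-index n e i i<n) ⟩
      suc (n + suc e)                    ∎
      where open ≡-Reasoning

    cancel : ∀ n e {x y} → (n + e) * x ≡ (n + e) * y → (n ≡ 0 → e ≡ 0 → x ≡ y) → x ≡ y
    cancel zero    zero    _  x≡y = x≡y refl refl
    cancel zero    (suc e) eq _   = *-cancelˡ-≡ _ _ (suc e) eq
    cancel (suc n) e       eq _   = *-cancelˡ-≡ _ _ (suc n + e) eq

    solves-suc : ∀ n e a → a + (n + suc e) < N →
      (n + e) * g (suc a) (n + e) e ≡ rhs e n →
      (∀ i → i < n → (n + suc e) * g a (n + suc e) (suc (suc e) + i) ≡ rhs (suc (suc e) + i) (n ∸ suc i)) →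
      (n + suc e) * g a (n + suc e) (suc e) ≡ rhs (suc e) n
    solves-suc n e a a+m<N ih-root ih-parts = cancel n e multiplied base
      where
      open ≡-Reasoning
      m = n + suc e
      Σg = ∑[ i < n ] g a m (suc (suc e) + i)
      distribute : ∀ x m y s → x * (m * (y + s)) ≡ m * (x * y) + x * (m * s)
      distribute = solve-∀
      multiplied : (n + e) * (m * g a m (suc e)) ≡ (n + e) * rhs (suc e) n
      multiplied = begin
          (n + e) * (m * g a m (suc e))
        ≡⟨ cong (λ z → (n + e) * (m * z)) (g-recurrence a n e a+m<N) ⟩
          (n + e) * (m * (g (suc a) (n + e) e + Σg))
        ≡⟨ distribute (n + e) m (g (suc a) (n + e) e) Σg ⟩
          m * ((n + e) * g (suc a) (n + e) e) + (n + e) * (m * Σg)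
        ≡⟨ cong₂ (λ u v → m * u + (n + e) * v) ih-root (sym (∑<-*ˡ n m _)) ⟩
          m * rhs e n + (n + e) * ∑[ i < n ] (m * g a m (suc (suc e) + i))
        ≡⟨ cong (λ v → m * rhs e n + (n + e) * v) (∑<-cong n ih-parts) ⟩
          m * rhs e n + (n + e) * ∑[ i < n ] rhs (suc (suc e) + i) (n ∸ suc i)
        ≡⟨ rhs-recurrence n e ⟨
          (n + e) * rhs (suc e) n
        ∎
      base : n ≡ 0 → e ≡ 0 → m * g a m (suc e) ≡ rhs (suc e) n
      base refl refl = begin
        1 * g a 1 1        ≡⟨ *-identityˡ _ ⟩
        g a 1 1            ≡⟨ g-recurrence a 0 0 a+m<N ⟩
        g (suc a) 0 0 + 0  ≡⟨ cong (_+ 0) (g-one (suc a)) ⟩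
        1                  ∎

    step : ∀ n → (∀ {n′} → n′ < n → Solves n′) → Solves n
    step n solves-< = solves-n
      where
      solves-n : Solves n
      solves-n zero    a _     = solves-0 n a
      solves-n (suc e) a a+m<N = solves-suc n e a a+m<N
        (solves-n e (suc a) (subst (_< N) (trans (cong (a +_) (+-suc n e)) (+-suc a (n + e))) a+m<N))
        (λ i i<n → subst (λ z → z * g a z (suc (suc e) + i) ≡ rhs (suc (suc e) + i) (n ∸ suc i)) (split-index n e i i<n)
                         (solves-< (∸-monoʳ-< {n} {suc i} {0} z<s i<n) (suc (suc e) + i) a
                                   (subst (λ z → a + z < N) (sym (split-index n e i i<n)) a+m<N)))

  solution : ∀ n → Solves n
  solution = <-rec Solves step

T-injective : ∀ {a b} → (T a → T b) → (T b → T a) → a ≡ b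
T-injective {true}  {true}  _ _ = refl
T-injective {true}  {false} f _ = ⊥-elim (f tt)
T-injective {false} {true}  _ g = ⊥-elim (g tt)
T-injective {false} {false} _ _ = refl

T-∧ˡ : ∀ {a b} → T (a ∧ b) → T a
T-∧ˡ {true} _ = tt

T-∧ʳ : ∀ {a b} → T (a ∧ b) → T b
T-∧ʳ {true} t = t

T-∧⁺ : ∀ {a b} → T a → T b → T (a ∧ b)
T-∧⁺ {true} _ t = t

T-not⁻ : ∀ {a} → T (not a) → ¬ T a
T-not⁻ {true} ()

T-not⁺ : ∀ {a} → ¬ T a → T (not a)
T-not⁺ {true}  ¬t = ¬t tt
T-not⁺ {false} _  = tt

≡ᵇ-false : ∀ {m n} → m ≢ n → (m ≡ᵇ n) ≡ false
≡ᵇ-false {m} {n} m≢n with m ≡ᵇ n in eq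
... | true  = ⊥-elim (m≢n (≡ᵇ⇒≡ m n (subst T (sym eq) tt)))
... | false = refl

≡ᵇ-true : ∀ {m n} → m ≡ n → (m ≡ᵇ n) ≡ true
≡ᵇ-true {m} {n} m≡n with m ≡ᵇ n in eq
... | true  = refl
... | false = ⊥-elim (subst T eq (≡⇒≡ᵇ m n m≡n))

ind : Bool → ℕ
ind true  = 1
ind false = 0

ind-∧ : ∀ a b → ind (a ∧ b) ≡ ind a * ind b
ind-∧ true  b = sym (+-identityʳ (ind b))
ind-∧ false b = refl

ind-T : ∀ {b} → T b → ind b ≡ 1
ind-T {true} _ = refl

ind≡0⇒false : ∀ {b} → ind b ≡ 0 → b ≡ false
ind≡0⇒false {false} _ = refl

∑<-ind-≡ᵇ : ∀ v n → v < n → ∑[ r < n ] ind (v ≡ᵇ r) ≡ 1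
∑<-ind-≡ᵇ zero    (suc n) _         = cong suc (∑<-0 n)
∑<-ind-≡ᵇ (suc v) (suc n) (s≤s v<n) = ∑<-ind-≡ᵇ v n v<n

∑<-ind≤ : ∀ n (x : ℕ → Bool) → ∑[ i < n ] ind (x i) ≤ n
∑<-ind≤ zero    x = z≤n
∑<-ind≤ (suc n) x = +-mono-≤ (ind≤1 (x 0)) (∑<-ind≤ n (x ∘ suc))
  where
  ind≤1 : ∀ b → ind b ≤ 1
  ind≤1 true  = s≤s z≤n
  ind≤1 false = z≤n

module FirstHit (x : ℕ → Bool) (t : ℕ) where
  prefix : ℕ → ℕ
  prefix M = ∑[ i < M ] ind (x i)

  hit : ℕ → ℕ
  hit j = ind (x j ∧ (prefix (suc j) ≡ᵇ t))

  private
    prefix-suc : ∀ M b → x M ≡ b → prefix (suc M) ≡ prefix M + ind b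
    prefix-suc M b xM = trans (∑<-suc M (ind ∘ x)) (cong (λ b → prefix M + ind b) xM)

    hit-false : ∀ M → x M ≡ false → hit M ≡ 0
    hit-false M xM = cong (λ b → ind (b ∧ (prefix (suc M) ≡ᵇ t))) xM

    hit-true : ∀ M → x M ≡ true → hit M ≡ ind (prefix M + 1 ≡ᵇ t)
    hit-true M xM = cong₂ (λ b p → ind (b ∧ (p ≡ᵇ t))) xM (prefix-suc M true xM)

    no-hit : ∀ M → prefix M < t → ∑< M hit ≡ 0
    no-hit zero    _        = refl
    no-hit (suc M) prefix<t = begin
      ∑< (suc M) hit           ≡⟨ ∑<-suc M hit ⟩
      ∑< M hit + hit M         ≡⟨ cong₂ _+_ (no-hit M (≤-<-trans (m≤m+n _ _) (subst (_< t) (prefix-suc M (x M) refl) prefix<t)))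
                                            (cong (ind ∘ (x M ∧_)) (≡ᵇ-false (λ eq → <-irrefl eq prefix<t))) ⟩
      0 + ind (x M ∧ false)    ≡⟨ cong ind (∧-zeroʳ (x M)) ⟩
      0                        ∎
      where open ≡-Reasoning

  unique-hit : ∀ M → 1 ≤ t → t ≤ prefix M → ∑< M hit ≡ 1
  unique-hit zero    1≤t t≤0 = ⊥-elim (<-irrefl refl (≤-trans 1≤t t≤0))
  unique-hit (suc M) 1≤t t≤prefix with t ≤? prefix M | x M in xM
  ... | yes t≤prefix′ | false = trans (∑<-suc M hit) (cong₂ _+_ (unique-hit M 1≤t t≤prefix′) (hit-false M xM))
  ... | yes t≤prefix′ | true  = trans (∑<-suc M hit) (cong₂ _+_ (unique-hit M 1≤t t≤prefix′)
      (trans (hit-true M xM) (cong ind (≡ᵇ-false λ eq → <-irrefl (sym eq) (≤-<-trans t≤prefix′ (m<m+n (prefix M) z<s))))))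
  ... | no  t≰prefix′ | false = ⊥-elim (t≰prefix′ (subst (t ≤_) (trans (prefix-suc M false xM) (+-identityʳ _)) t≤prefix))
  ... | no  t≰prefix′ | true  = trans (∑<-suc M hit) (cong₂ _+_ (no-hit M (≰⇒> t≰prefix′))
      (trans (hit-true M xM) (cong ind (≡ᵇ-true (≤-antisym (subst (_≤ t) (+-comm 1 (prefix M)) (≰⇒> t≰prefix′))
                                                             (subst (t ≤_) (prefix-suc M true xM) t≤prefix))))))

filterᵇ-map : {A B : Set} (p : B → Bool) (f : A → B) (xs : List A) →
              filterᵇ p (map f xs) ≡ map f (filterᵇ (p ∘ f) xs)
filterᵇ-map p f []       = refl
filterᵇ-map p f (x ∷ xs) with p (f x)
... | true  = cong (f x ∷_) (filterᵇ-map p f xs)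
... | false = filterᵇ-map p f xs

filterᵇ-≗ : {A : Set} {p q : A → Bool} → (∀ x → p x ≡ q x) → ∀ xs → filterᵇ p xs ≡ filterᵇ q xs
filterᵇ-≗         eq []       = refl
filterᵇ-≗ {q = q} eq (x ∷ xs) rewrite eq x with q x
... | true  = cong (x ∷_) (filterᵇ-≗ eq xs)
... | false = filterᵇ-≗ eq xs

filterᵇ-∘ : {A : Set} (p q : A → Bool) (xs : List A) → filterᵇ p (filterᵇ q xs) ≡ filterᵇ (λ x → q x ∧ p x) xs
filterᵇ-∘ p q []       = refl
filterᵇ-∘ p q (x ∷ xs) with q x
... | false = filterᵇ-∘ p q xs
... | true with p x
...   | true  = cong (x ∷_) (filterᵇ-∘ p q xs)
...   | false = filterᵇ-∘ p q xs

∈-filterᵇ⁻ : {A : Set} (p : A → Bool) (xs : List A) {x : A} → x ∈ filterᵇ p xs → x ∈ xs × T (p x)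
∈-filterᵇ⁻ p xs = ∈-filter⁻ (T? ∘ p) {xs = xs}

∈-filterᵇ⁺ : {A : Set} (p : A → Bool) {xs : List A} {x : A} → x ∈ xs → T (p x) → x ∈ filterᵇ p xs
∈-filterᵇ⁺ p = ∈-filter⁺ (T? ∘ p)

all⇒filterᵇ≡id : {A : Set} (p : A → Bool) (S : List A) → T (all p S) → filterᵇ p S ≡ S
all⇒filterᵇ≡id p []      _ = refl
all⇒filterᵇ≡id p (x ∷ S) t with p x
... | true = cong (x ∷_) (all⇒filterᵇ≡id p S t)

all⇒filterᵇ-not≡[] : {A : Set} (p : A → Bool) (S : List A) → T (all p S) → filterᵇ (not ∘ p) S ≡ []
all⇒filterᵇ-not≡[] p []      _ = refl
all⇒filterᵇ-not≡[] p (x ∷ S) t with p x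
... | true = all⇒filterᵇ-not≡[] p S t

¬all⇒filterᵇ-not-nonnull : {A : Set} (p : A → Bool) (S : List A) → all p S ≡ false → null (filterᵇ (not ∘ p) S) ≡ false
¬all⇒filterᵇ-not-nonnull p (x ∷ S) ¬all with p x
... | true  = ¬all⇒filterᵇ-not-nonnull p S ¬all
... | false = refl

all∧≡filterᵇ∧null : {A : Set} (p : A → Bool) (Q : List A → Bool) (S : List A) →
                    (all p S ∧ Q S) ≡ (Q (filterᵇ p S) ∧ null (filterᵇ (not ∘ p) S))
all∧≡filterᵇ∧null p Q S with all p S in allp
... | true  rewrite all⇒filterᵇ≡id p S (subst T (sym allp) tt) | all⇒filterᵇ-not≡[] p S (subst T (sym allp) tt) =
  sym (∧-identityʳ (Q S))
... | false rewrite ¬all⇒filterᵇ-not-nonnull p S allp = sym (∧-zeroʳ (Q (filterᵇ p S)))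

count : {A : Set} → (List A → Bool) → List A → ℕ
count P L = length (filterᵇ P (sublists L))

count-[] : {A : Set} (P : List A → Bool) → count P [] ≡ ind (P [])
count-[] P with P []
... | true  = refl
... | false = refl

count-∷ : {A : Set} (P : List A → Bool) (x : A) (L : List A) → count P (x ∷ L) ≡ count P L + count (P ∘ (x ∷_)) L
count-∷ P x L = begin
    length (filterᵇ P (sublists L ++ map (x ∷_) (sublists L)))
  ≡⟨ cong length (filter-++ (T? ∘ P) (sublists L) _) ⟩
    length (filterᵇ P (sublists L) ++ filterᵇ P (map (x ∷_) (sublists L)))
  ≡⟨ length-++ (filterᵇ P (sublists L)) ⟩
    count P L + length (filterᵇ P (map (x ∷_) (sublists L)))
  ≡⟨ cong (λ l → count P L + length l) (filterᵇ-map P (x ∷_) (sublists L)) ⟩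
    count P L + length (map (x ∷_) (filterᵇ (P ∘ (x ∷_)) (sublists L)))
  ≡⟨ cong (count P L +_) (length-map {A = List _} (x ∷_) (filterᵇ (P ∘ (x ∷_)) (sublists L))) ⟩
    count P L + count (P ∘ (x ∷_)) L
  ∎
  where open ≡-Reasoning

count-cong : {A : Set} (V : A → Set) {P Q : List A → Bool} (L : List A) → All V L →
             (∀ S → All V S → P S ≡ Q S) → count P L ≡ count Q L
count-cong V {P} {Q} []      []       eq = trans (count-[] P) (trans (cong ind (eq [] [])) (sym (count-[] Q)))
count-cong V {P} {Q} (x ∷ L) (vx ∷ vL) eq = begin
  count P (x ∷ L)                          ≡⟨ count-∷ P x L ⟩
  count P L + count (P ∘ (x ∷_)) L         ≡⟨ cong₂ _+_ (count-cong V L vL eq) (count-cong V L vL (λ S vS → eq (x ∷ S) (vx ∷ vS))) ⟩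
  count Q L + count (Q ∘ (x ∷_)) L         ≡⟨ count-∷ Q x L ⟨
  count Q (x ∷ L)                          ∎
  where open ≡-Reasoning

count-≗ : {A : Set} {P Q : List A → Bool} (L : List A) → (∀ S → P S ≡ Q S) → count P L ≡ count Q L
count-≗ L eq = count-cong (λ _ → ⊤) L (universal _ L) (λ S _ → eq S)

count-false : {A : Set} (L : List A) → count (λ _ → false) L ≡ 0
count-false []      = refl
count-false (x ∷ L) = trans (count-∷ _ x L) (cong₂ _+_ (count-false L) (count-false L))

count-null : {A : Set} (L : List A) → count null L ≡ 1
count-null []      = refl
count-null (x ∷ L) = trans (count-∷ null x L) (cong₂ _+_ (count-null L) (count-false L))

count-product : {A : Set} (g : A → Bool) (Q R : List A → Bool) (L : List A) →
  count (λ S → Q (filterᵇ g S) ∧ R (filterᵇ (not ∘ g) S)) L ≡ count Q (filterᵇ g L) * count R (filterᵇ (not ∘ g) L)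
count-product g Q R [] = trans (count-[] (λ S → Q (filterᵇ g S) ∧ R (filterᵇ (not ∘ g) S))) (trans (ind-∧ (Q []) (R [])) (sym (cong₂ _*_ (count-[] Q) (count-[] R))))
count-product g Q R (x ∷ L) with g x in gx
... | true = begin
    count P (x ∷ L)
  ≡⟨ count-∷ P x L ⟩
    count P L + count (P ∘ (x ∷_)) L
  ≡⟨ cong (count P L +_) (count-≗ L (λ S → cong₂ (λ l l′ → Q l ∧ R l′) (keep S) (drop S))) ⟩
    count P L + count (λ S → Q (x ∷ filterᵇ g S) ∧ R (filterᵇ (not ∘ g) S)) L
  ≡⟨ cong₂ _+_ (count-product g Q R L) (count-product g (Q ∘ (x ∷_)) R L) ⟩
    count Q L₁ * count R L₂ + count (Q ∘ (x ∷_)) L₁ * count R L₂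
  ≡⟨ *-distribʳ-+ (count R L₂) (count Q L₁) _ ⟨
    (count Q L₁ + count (Q ∘ (x ∷_)) L₁) * count R L₂
  ≡⟨ cong (_* count R L₂) (count-∷ Q x L₁) ⟨
    count Q (x ∷ L₁) * count R L₂
  ∎
  where
  open ≡-Reasoning
  P = λ S → Q (filterᵇ g S) ∧ R (filterᵇ (not ∘ g) S)
  L₁ = filterᵇ g L
  L₂ = filterᵇ (not ∘ g) L
  keep : ∀ S → filterᵇ g (x ∷ S) ≡ x ∷ filterᵇ g S
  keep S rewrite gx = refl
  drop : ∀ S → filterᵇ (not ∘ g) (x ∷ S) ≡ filterᵇ (not ∘ g) S
  drop S rewrite gx = refl
... | false = begin
    count P (x ∷ L)
  ≡⟨ count-∷ P x L ⟩
    count P L + count (P ∘ (x ∷_)) L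
  ≡⟨ cong (count P L +_) (count-≗ L (λ S → cong₂ (λ l l′ → Q l ∧ R l′) (drop S) (keep S))) ⟩
    count P L + count (λ S → Q (filterᵇ g S) ∧ R (x ∷ filterᵇ (not ∘ g) S)) L
  ≡⟨ cong₂ _+_ (count-product g Q R L) (count-product g Q (R ∘ (x ∷_)) L) ⟩
    count Q L₁ * count R L₂ + count Q L₁ * count (R ∘ (x ∷_)) L₂
  ≡⟨ *-distribˡ-+ (count Q L₁) (count R L₂) _ ⟨
    count Q L₁ * (count R L₂ + count (R ∘ (x ∷_)) L₂)
  ≡⟨ cong (count Q L₁ *_) (count-∷ R x L₂) ⟨
    count Q L₁ * count R (x ∷ L₂)
  ∎
  where
  open ≡-Reasoning
  P = λ S → Q (filterᵇ g S) ∧ R (filterᵇ (not ∘ g) S)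
  L₁ = filterᵇ g L
  L₂ = filterᵇ (not ∘ g) L
  keep : ∀ S → filterᵇ (not ∘ g) (x ∷ S) ≡ x ∷ filterᵇ (not ∘ g) S
  keep S rewrite gx = refl
  drop : ∀ S → filterᵇ g (x ∷ S) ≡ filterᵇ g S
  drop S rewrite gx = refl

count-sum : {A : Set} (V : A → Set) (P : List A → Bool) (h : ℕ → List A → Bool) (n : ℕ) (L : List A) → All V L →
  (∀ S → All V S → ind (P S) ≡ ∑[ c < n ] ind (P S ∧ h c S)) →
  count P L ≡ ∑[ c < n ] count (λ S → P S ∧ h c S) L
count-sum V P h n [] [] partition = begin
  count P []                               ≡⟨ count-[] P ⟩
  ind (P [])                               ≡⟨ partition [] [] ⟩
  ∑[ c < n ] ind (P [] ∧ h c [])           ≡⟨ ∑<-cong n (λ c _ → count-[] (λ S → P S ∧ h c S)) ⟨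
  ∑[ c < n ] count (λ S → P S ∧ h c S) []  ∎
  where open ≡-Reasoning
count-sum V P h n (x ∷ L) (vx ∷ vL) partition = begin
    count P (x ∷ L)
  ≡⟨ count-∷ P x L ⟩
    count P L + count (P ∘ (x ∷_)) L
  ≡⟨ cong₂ _+_ (count-sum V P h n L vL partition)
               (count-sum V (P ∘ (x ∷_)) (λ c → h c ∘ (x ∷_)) n L vL (λ S vS → partition (x ∷ S) (vx ∷ vS))) ⟩
    ∑[ c < n ] count (λ S → P S ∧ h c S) L + ∑[ c < n ] count (λ S → P (x ∷ S) ∧ h c (x ∷ S)) L
  ≡⟨ ∑<-distrib-+ n _ _ ⟨
    ∑[ c < n ] (count (λ S → P S ∧ h c S) L + count (λ S → P (x ∷ S) ∧ h c (x ∷ S)) L)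
  ≡⟨ ∑<-cong n (λ c _ → count-∷ (λ S → P S ∧ h c S) x L) ⟨
    ∑[ c < n ] count (λ S → P S ∧ h c S) (x ∷ L)
  ∎
  where open ≡-Reasoning

-- Chords, roots and crossings

Separates : ℕ → Pair → Set
Separates v (i , k) = i < v × v < k

separates⇒Separates : ∀ v x → T (separates v x) → Separates v x
separates⇒Separates v (i , k) t = <ᵇ⇒< i v (T-∧ˡ t) , <ᵇ⇒< v k (T-∧ʳ {i <ᵇ v} t)

Separates⇒separates : ∀ v x → Separates v x → T (separates v x)
Separates⇒separates v (i , k) (i<v , v<k) = T-∧⁺ (<⇒<ᵇ i<v) (<⇒<ᵇ v<k)

-- The roots of S are the vertices of its root part, the part containing the base.
isRoot : List Pair → ℕ → Bool
isRoot S v = not (any (separates v) S)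

isRoot⇒¬Separates : ∀ S v → T (isRoot S v) → ∀ {x} → x ∈ S → ¬ Separates v x
isRoot⇒¬Separates S v root x∈S sep =
  T-not⁻ {any (separates v) S} root (any⁺ (separates v) (lose x∈S (Separates⇒separates v _ sep)))

¬Separates⇒isRoot : ∀ S v → (∀ {x} → x ∈ S → ¬ Separates v x) → T (isRoot S v)
¬Separates⇒isRoot S v ¬sep = T-not⁺ λ t →
  let (x , x∈S , sep) = find (any⁻ (separates v) S t) in ¬sep x∈S (separates⇒Separates v x sep)

isRoot-⊆ : ∀ S S′ v → (∀ {x} → x ∈ S′ → x ∈ S) → T (isRoot S v) → T (isRoot S′ v)
isRoot-⊆ S S′ v S′⊆S root = ¬Separates⇒isRoot S′ v (isRoot⇒¬Separates S v root ∘ S′⊆S)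

¬isRoot⇒Separates : ∀ S v → isRoot S v ≡ false → ∃ λ x → x ∈ S × Separates v x
¬isRoot⇒Separates S v ¬root with any (separates v) S in anySep
... | true = let (x , x∈S , sep) = find (any⁻ (separates v) S (subst T (sym anySep) tt)) in
             x , x∈S , separates⇒Separates v x sep

Separates⇒¬isRoot : ∀ S v {x} → x ∈ S → Separates v x → isRoot S v ≡ false
Separates⇒¬isRoot S v x∈S sep with isRoot S v in root
... | true  = ⊥-elim (isRoot⇒¬Separates S v (subst T (sym root) tt) x∈S sep)
... | false = refl

Crosses : Pair → Pair → Set
Crosses (a , b) (c , e) = (a < c × c < b × b < e) ⊎ (c < a × a < e × e < b)

crosses⇒Crosses : ∀ x y → T (crosses x y) → Crosses x y
crosses⇒Crosses (a , b) (c , e) t with Equivalence.to T-∨ t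
... | inj₁ t′ = inj₁ (<ᵇ⇒< a c (T-∧ˡ t′) , <ᵇ⇒< c b (T-∧ˡ (T-∧ʳ {a <ᵇ c} t′)) , <ᵇ⇒< b e (T-∧ʳ {c <ᵇ b} (T-∧ʳ {a <ᵇ c} t′)))
... | inj₂ t′ = inj₂ (<ᵇ⇒< c a (T-∧ˡ t′) , <ᵇ⇒< a e (T-∧ˡ (T-∧ʳ {c <ᵇ a} t′)) , <ᵇ⇒< e b (T-∧ʳ {a <ᵇ e} (T-∧ʳ {c <ᵇ a} t′)))

Crosses⇒crosses : ∀ x y → Crosses x y → T (crosses x y)
Crosses⇒crosses (a , b) (c , e) (inj₁ (p , q , r)) = Equivalence.from T-∨ (inj₁ (T-∧⁺ (<⇒<ᵇ p) (T-∧⁺ (<⇒<ᵇ q) (<⇒<ᵇ r))))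
Crosses⇒crosses (a , b) (c , e) (inj₂ (p , q , r)) = Equivalence.from T-∨ (inj₂ (T-∧⁺ (<⇒<ᵇ p) (T-∧⁺ (<⇒<ᵇ q) (<⇒<ᵇ r))))

Crosses-sym : ∀ x y → Crosses x y → Crosses y x
Crosses-sym _ _ (inj₁ c) = inj₂ c
Crosses-sym _ _ (inj₂ c) = inj₁ c

Crosses-irrefl : ∀ x → ¬ Crosses x x
Crosses-irrefl _ (inj₁ (a<a , _)) = <-irrefl refl a<a
Crosses-irrefl _ (inj₂ (a<a , _)) = <-irrefl refl a<a

NonCrossing : List Pair → Set
NonCrossing S = ∀ {x y} → x ∈ S → y ∈ S → ¬ Crosses x y

NonCrossing-⊆ : ∀ S S′ → (∀ {x} → x ∈ S′ → x ∈ S) → NonCrossing S → NonCrossing S′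
NonCrossing-⊆ S S′ S′⊆S nc x∈ y∈ = nc (S′⊆S x∈) (S′⊆S y∈)

noncrossing⇒NonCrossing : ∀ S → T (noncrossing S) → NonCrossing S
noncrossing⇒NonCrossing (z ∷ S) nc (here refl) (here refl) = Crosses-irrefl z
noncrossing⇒NonCrossing (z ∷ S) nc (here refl) (there y∈) =
  T-not⁻ (All-lookup (all⁺ _ S (T-∧ˡ nc)) y∈) ∘ Crosses⇒crosses z _
noncrossing⇒NonCrossing (z ∷ S) nc (there x∈) (here refl) =
  T-not⁻ (All-lookup (all⁺ _ S (T-∧ˡ nc)) x∈) ∘ Crosses⇒crosses z _ ∘ Crosses-sym _ z
noncrossing⇒NonCrossing (z ∷ S) nc (there x∈) (there y∈) =
  noncrossing⇒NonCrossing S (T-∧ʳ {all (λ y → not (crosses z y)) S} nc) x∈ y∈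

NonCrossing⇒noncrossing : ∀ S → NonCrossing S → T (noncrossing S)
NonCrossing⇒noncrossing []      _  = tt
NonCrossing⇒noncrossing (z ∷ S) nc =
  T-∧⁺ (all⁻ (λ y → not (crosses z y)) (tabulate λ y∈ → T-not⁺ (nc (here refl) (there y∈) ∘ crosses⇒Crosses z _)))
       (NonCrossing⇒noncrossing S (λ x∈ y∈ → nc (there x∈) (there y∈)))

-- Chords of the sub-polygon with vertices a, a+1, …, a+m; its base (a , a + m) counts as a chord.
IsChord : ℕ → ℕ → Pair → Set
IsChord a m (i , k) = a ≤ i × 2 + i ≤ k × k ≤ a + m

isChord : ℕ → ℕ → Pair → Bool
isChord a m (i , k) = (a ≤ᵇ i) ∧ (2 + i ≤ᵇ k) ∧ (k ≤ᵇ a + m)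

isChord⇒IsChord : ∀ a m x → T (isChord a m x) → IsChord a m x
isChord⇒IsChord a m (i , k) t =
  ≤ᵇ⇒≤ a i (T-∧ˡ t) , ≤ᵇ⇒≤ (2 + i) k (T-∧ˡ (T-∧ʳ {a ≤ᵇ i} t)) , ≤ᵇ⇒≤ k (a + m) (T-∧ʳ {2 + i ≤ᵇ k} (T-∧ʳ {a ≤ᵇ i} t))

IsChord⇒isChord : ∀ a m x → IsChord a m x → T (isChord a m x)
IsChord⇒isChord a m (i , k) (a≤i , i+2≤k , k≤a+m) = T-∧⁺ (≤⇒≤ᵇ a≤i) (T-∧⁺ (≤⇒≤ᵇ i+2≤k) (≤⇒≤ᵇ k≤a+m))

Chords : ℕ → ℕ → List Pair → Set
Chords a m = All (T ∘ isChord a m)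

rootCount : ℕ → ℕ → List Pair → ℕ
rootCount a m S = ∑[ i < suc m ] ind (isRoot S (a + i))

rooted : ℕ → ℕ → ℕ → List Pair → Bool
rooted a m r S = noncrossing S ∧ (rootCount a m S ≡ᵇ suc r)

rootCount≤ : ∀ a m S → rootCount a m S ≤ suc m
rootCount≤ a m S = ∑<-ind≤ (suc m) (isRoot S ∘ (a +_))

isRoot-≤ : ∀ a m S v → Chords a m S → v ≤ a → T (isRoot S v)
isRoot-≤ a m S v chords v≤a = ¬Separates⇒isRoot S v λ {x} x∈S → separated x (All-lookup chords x∈S)
  where
  separated : ∀ x → T (isChord a m x) → ¬ Separates v x
  separated (i , k) chord (i<v , _) = <-irrefl refl (<-≤-trans i<v (≤-trans v≤a (proj₁ (isChord⇒IsChord a m (i , k) chord))))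

isRoot-≥ : ∀ a m S v → Chords a m S → a + m ≤ v → T (isRoot S v)
isRoot-≥ a m S v chords a+m≤v = ¬Separates⇒isRoot S v λ {x} x∈S → separated x (All-lookup chords x∈S)
  where
  separated : ∀ x → T (isChord a m x) → ¬ Separates v x
  separated (i , k) chord (_ , v<k) = <-irrefl refl (<-≤-trans v<k (≤-trans (proj₂ (proj₂ (isChord⇒IsChord a m (i , k) chord))) a+m≤v))

rootCount-inner : ∀ a m S → Chords a (suc m) S → rootCount a (suc m) S ≡ suc (∑[ i < m ] ind (isRoot S (a + suc i)) + 1)
rootCount-inner a m S chords = cong₂ _+_
  (ind-T (isRoot-≤ a (suc m) S (a + 0) chords (≤-reflexive (+-identityʳ a))))
  (trans (∑<-suc m (λ i → ind (isRoot S (a + suc i))))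
         (cong (∑[ i < m ] ind (isRoot S (a + suc i)) +_) (ind-T (isRoot-≥ a (suc m) S (a + suc m) chords ≤-refl))))

2≤rootCount : ∀ a m S → Chords a (suc m) S → 2 ≤ rootCount a (suc m) S
2≤rootCount a m S chords = subst (2 ≤_) (sym (rootCount-inner a m S chords)) (s≤s (subst (1 ≤_) (+-comm 1 _) (s≤s z≤n)))

farthest : ℕ → List Pair → ℕ
farthest a []            = 0
farthest a ((i , k) ∷ S) = if i ≡ᵇ a then k ⊔ farthest a S else farthest a S

≤-farthest : ∀ a S k → (a , k) ∈ S → k ≤ farthest a S
≤-farthest a ((i , k) ∷ S) k (here refl) rewrite ≡ᵇ-true {a} {a} refl = m≤m⊔n k (farthest a S)
≤-farthest a ((i , k′) ∷ S) k (there ak∈S) with i ≡ᵇ a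
... | true  = ≤-trans (≤-farthest a S k ak∈S) (m≤n⊔m k′ (farthest a S))
... | false = ≤-farthest a S k ak∈S

farthest-∈ : ∀ a S → farthest a S ≡ 0 ⊎ (a , farthest a S) ∈ S
farthest-∈ a []            = inj₁ refl
farthest-∈ a ((i , k) ∷ S) with i ≡ᵇ a in i≡a
... | false = Data.Sum.map₂ there (farthest-∈ a S)
... | true with ⊔-sel k (farthest a S)
...   | inj₁ eq rewrite eq | ≡ᵇ⇒≡ i a (subst T (sym i≡a) tt) = inj₂ (here refl)
...   | inj₂ eq rewrite eq = Data.Sum.map₂ there (farthest-∈ a S)

-- Splitting a dissection

module SplitAt (a j m′ : ℕ) where
  c = a + j
  m = j + m′

  inLeft : Pair → Bool
  inLeft (i , k) = k ≤ᵇ c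

  inRight : Pair → Bool
  inRight (i , k) = c ≤ᵇ i

  module _ (S : List Pair) where
    S₁ = filterᵇ inLeft S
    S₂ = filterᵇ (not ∘ inLeft) S

    S₁⊆S : ∀ {x} → x ∈ S₁ → x ∈ S
    S₁⊆S = proj₁ ∘ ∈-filterᵇ⁻ inLeft S

    S₂⊆S : ∀ {x} → x ∈ S₂ → x ∈ S
    S₂⊆S = proj₁ ∘ ∈-filterᵇ⁻ (not ∘ inLeft) S

    split-∈ : ∀ {x} → x ∈ S → (x ∈ S₁ × T (inLeft x)) ⊎ (x ∈ S₂ × ¬ T (inLeft x))
    split-∈ {x} x∈S with inLeft x in left
    ... | true  = inj₁ (∈-filterᵇ⁺ inLeft x∈S (subst T (sym left) tt) , tt)
    ... | false = inj₂ (∈-filterᵇ⁺ (not ∘ inLeft) x∈S (subst (T ∘ not) (sym left) tt) , λ ())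

    isRoot-left : T (isRoot S c) → ∀ v → v ≤ c → isRoot S v ≡ isRoot S₁ v
    isRoot-left c-root v v≤c = T-injective (isRoot-⊆ S S₁ v S₁⊆S) λ root₁ → ¬Separates⇒isRoot S v (separated root₁)
      where
      separated : T (isRoot S₁ v) → ∀ {x} → x ∈ S → ¬ Separates v x
      separated root₁ {i , k} x∈S (i<v , v<k) with split-∈ x∈S
      ... | inj₁ (x∈S₁ , _)    = isRoot⇒¬Separates S₁ v root₁ x∈S₁ (i<v , v<k)
      ... | inj₂ (_ , ¬left) = isRoot⇒¬Separates S c c-root x∈S (<-≤-trans i<v v≤c , ≰⇒> (¬left ∘ ≤⇒≤ᵇ))

    isRoot-right : ∀ v → c ≤ v → isRoot S v ≡ isRoot S₂ v
    isRoot-right v c≤v = T-injective (isRoot-⊆ S S₂ v S₂⊆S) λ root₂ → ¬Separates⇒isRoot S v (separated root₂)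
      where
      separated : T (isRoot S₂ v) → ∀ {x} → x ∈ S → ¬ Separates v x
      separated root₂ {i , k} x∈S (i<v , v<k) with split-∈ x∈S
      ... | inj₁ (_ , left)  = <-irrefl refl (<-≤-trans v<k (≤-trans (≤ᵇ⇒≤ k c left) c≤v))
      ... | inj₂ (x∈S₂ , _) = isRoot⇒¬Separates S₂ v root₂ x∈S₂ (i<v , v<k)

    c-isRoot-S₁ : T (isRoot S₁ c)
    c-isRoot-S₁ = ¬Separates⇒isRoot S₁ c λ {x} x∈S₁ → separated x (proj₂ (∈-filterᵇ⁻ inLeft S x∈S₁))
      where
      separated : ∀ x → T (inLeft x) → ¬ Separates c x
      separated (i , k) left (_ , c<k) = <-irrefl refl (<-≤-trans c<k (≤ᵇ⇒≤ k c left))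

    inRight⇒c-isRoot : T (all inRight S₂) → T (isRoot S c)
    inRight⇒c-isRoot right = ¬Separates⇒isRoot S c λ {x} x∈S → separated x x∈S
      where
      separated : ∀ x → x ∈ S → ¬ Separates c x
      separated (i , k) x∈S (i<c , c<k) with split-∈ x∈S
      ... | inj₁ (_ , left)  = <-irrefl refl (<-≤-trans c<k (≤ᵇ⇒≤ k c left))
      ... | inj₂ (x∈S₂ , _) = <-irrefl refl (<-≤-trans i<c (≤ᵇ⇒≤ c i (All-lookup (all⁺ inRight S₂ right) x∈S₂)))

    c-isRoot⇒inRight : T (isRoot S c) → T (all inRight S₂)
    c-isRoot⇒inRight c-root = all⁻ inRight (tabulate λ {x} → right x)
      where
      right : ∀ x → x ∈ S₂ → T (inRight x)
      right (i , k) x∈S₂ with i <? c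
      ... | no  i≮c = ≤⇒≤ᵇ (≮⇒≥ i≮c)
      ... | yes i<c = ⊥-elim (isRoot⇒¬Separates S c c-root (S₂⊆S x∈S₂)
                        (i<c , ≰⇒> (T-not⁻ (proj₂ (∈-filterᵇ⁻ (not ∘ inLeft) S x∈S₂)) ∘ ≤⇒≤ᵇ)))

    rootCount-left : T (isRoot S c) → rootCount a j S ≡ rootCount a j S₁
    rootCount-left c-root = ∑<-cong (suc j) λ i i≤j → cong ind (isRoot-left c-root (a + i) (+-monoʳ-≤ a (s≤s⁻¹ i≤j)))

    -- The vertex c is counted on both sides.
    rootCount-split : T (isRoot S c) → rootCount a m S + 1 ≡ rootCount a j S₁ + rootCount c m′ S₂
    rootCount-split c-root = begin
        ∑< (suc (j + m′)) f + 1
      ≡⟨ cong (λ z → ∑< z f + 1) (sym (+-suc j m′)) ⟩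
        ∑< (j + suc m′) f + 1
      ≡⟨ cong (_+ 1) (∑<-+ j (suc m′) f) ⟩
        ∑< j f + ∑[ i < suc m′ ] f (j + i) + 1
      ≡⟨ cong₂ (λ u v → u + v + 1)
               (∑<-cong j λ i i<j → cong ind (isRoot-left c-root (a + i) (+-monoʳ-≤ a (<⇒≤ i<j))))
               (∑<-cong (suc m′) λ i _ → trans (cong (ind ∘ isRoot S) (sym (+-assoc a j i)))
                                               (cong ind (isRoot-right (c + i) (m≤m+n c i)))) ⟩
        ∑< j f₁ + ∑< (suc m′) f₂ + 1
      ≡⟨ +-comm-middle (∑< j f₁) (∑< (suc m′) f₂) ⟩
        ∑< j f₁ + 1 + ∑< (suc m′) f₂
      ≡⟨ cong (λ z → ∑< j f₁ + z + ∑< (suc m′) f₂) (ind-T c-isRoot-S₁) ⟨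
        ∑< j f₁ + f₁ j + ∑< (suc m′) f₂
      ≡⟨ cong (_+ ∑< (suc m′) f₂) (∑<-suc j f₁) ⟨
        rootCount a j S₁ + rootCount c m′ S₂
      ∎
      where
      open ≡-Reasoning
      f  = λ i → ind (isRoot S (a + i))
      f₁ = λ i → ind (isRoot S₁ (a + i))
      f₂ = λ i → ind (isRoot S₂ (c + i))
      +-comm-middle : ∀ x y → x + y + 1 ≡ x + 1 + y
      +-comm-middle = solve-∀

    ¬Crosses-left-right : ∀ x y → T (inLeft x) → T (inRight y) → IsChord a m y → ¬ Crosses x y
    ¬Crosses-left-right (i , k) (i′ , k′) left right _ (inj₁ (_ , i′<k , _)) =
      <-irrefl refl (<-≤-trans i′<k (≤-trans (≤ᵇ⇒≤ k c left) (≤ᵇ⇒≤ c i′ right)))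
    ¬Crosses-left-right (i , k) (i′ , k′) left right (_ , i′+2≤k′ , _) (inj₂ (_ , _ , k′<k)) =
      <-irrefl refl (<-≤-trans k′<k (≤-trans (≤ᵇ⇒≤ k c left) (≤-trans (≤ᵇ⇒≤ c i′ right) (≤-trans (n≤1+n i′) (<⇒≤ i′+2≤k′)))))

    NonCrossing-join : Chords a m S → NonCrossing S₁ → NonCrossing S₂ → T (all inRight S₂) → NonCrossing S
    NonCrossing-join chords nc₁ nc₂ right {x} {y} x∈S y∈S with split-∈ x∈S | split-∈ y∈S
    ... | inj₁ (x∈S₁ , _)    | inj₁ (y∈S₁ , _)    = nc₁ x∈S₁ y∈S₁
    ... | inj₂ (x∈S₂ , _)    | inj₂ (y∈S₂ , _)    = nc₂ x∈S₂ y∈S₂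
    ... | inj₁ (_ , x-left) | inj₂ (y∈S₂ , _)    =
      ¬Crosses-left-right x y x-left (All-lookup (all⁺ inRight S₂ right) y∈S₂) (isChord⇒IsChord a m y (All-lookup chords y∈S))
    ... | inj₂ (x∈S₂ , _)    | inj₁ (_ , y-left) =
      ¬Crosses-left-right y x y-left (All-lookup (all⁺ inRight S₂ right) x∈S₂) (isChord⇒IsChord a m x (All-lookup chords x∈S))
        ∘ Crosses-sym x y

    rooted-split⇒ : ∀ r s → T (rooted a m (r + s) S ∧ (isRoot S c ∧ (rootCount a j S ≡ᵇ suc r)))
                          → T (rooted a j r S₁ ∧ (all inRight S₂ ∧ rooted c m′ s S₂))
    rooted-split⇒ r s t = T-∧⁺ (T-∧⁺ (NonCrossing⇒noncrossing S₁ (NonCrossing-⊆ S S₁ S₁⊆S nc)) (≡⇒≡ᵇ _ _ #root₁))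
                               (T-∧⁺ (c-isRoot⇒inRight c-root) (T-∧⁺ (NonCrossing⇒noncrossing S₂ (NonCrossing-⊆ S S₂ S₂⊆S nc)) (≡⇒≡ᵇ _ _ #root₂)))
      where
      t₁ = T-∧ˡ t
      t₂ = T-∧ʳ {rooted a m (r + s) S} t
      nc = noncrossing⇒NonCrossing S (T-∧ˡ t₁)
      #root : rootCount a m S ≡ suc (r + s)
      #root = ≡ᵇ⇒≡ _ _ (T-∧ʳ {noncrossing S} t₁)
      c-root = T-∧ˡ t₂
      #root₁ : rootCount a j S₁ ≡ suc r
      #root₁ = trans (sym (rootCount-left c-root)) (≡ᵇ⇒≡ _ _ (T-∧ʳ {isRoot S c} t₂))
      #root₂ : rootCount c m′ S₂ ≡ suc s
      #root₂ = +-cancelˡ-≡ (suc r) _ _ (begin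
        suc r + rootCount c m′ S₂                   ≡⟨ cong (_+ rootCount c m′ S₂) #root₁ ⟨
        rootCount a j S₁ + rootCount c m′ S₂        ≡⟨ rootCount-split c-root ⟨
        rootCount a m S + 1                         ≡⟨ cong (_+ 1) #root ⟩
        suc (r + s) + 1                             ≡⟨ +-suc-swap r s ⟩
        suc r + suc s                               ∎)
        where
        open ≡-Reasoning
        +-suc-swap : ∀ r s → suc (r + s) + 1 ≡ suc r + suc s
        +-suc-swap = solve-∀

    rooted-split⇐ : ∀ r s → Chords a m S → T (rooted a j r S₁ ∧ (all inRight S₂ ∧ rooted c m′ s S₂))
                                         → T (rooted a m (r + s) S ∧ (isRoot S c ∧ (rootCount a j S ≡ᵇ suc r)))
    rooted-split⇐ r s chords t = T-∧⁺ (T-∧⁺ (NonCrossing⇒noncrossing S (NonCrossing-join chords nc₁ nc₂ right)) (≡⇒≡ᵇ _ _ #root))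
                                      (T-∧⁺ c-root (≡⇒≡ᵇ _ _ (trans (rootCount-left c-root) #root₁)))
      where
      t₁ = T-∧ˡ t
      t₂ = T-∧ʳ {rooted a j r S₁} t
      nc₁ = noncrossing⇒NonCrossing S₁ (T-∧ˡ t₁)
      #root₁ : rootCount a j S₁ ≡ suc r
      #root₁ = ≡ᵇ⇒≡ _ _ (T-∧ʳ {noncrossing S₁} t₁)
      right = T-∧ˡ t₂
      t₃ = T-∧ʳ {all inRight S₂} t₂
      nc₂ = noncrossing⇒NonCrossing S₂ (T-∧ˡ t₃)
      #root₂ : rootCount c m′ S₂ ≡ suc s
      #root₂ = ≡ᵇ⇒≡ _ _ (T-∧ʳ {noncrossing S₂} t₃)
      c-root = inRight⇒c-isRoot right
      #root : rootCount a m S ≡ suc (r + s)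
      #root = +-cancelʳ-≡ 1 _ _ (trans (rootCount-split c-root) (trans (cong₂ _+_ #root₁ #root₂) (+-suc-swap r s)))
        where
        +-suc-swap : ∀ r s → suc r + suc s ≡ suc (r + s) + 1
        +-suc-swap = solve-∀

    rooted-split : ∀ r s → Chords a m S →
      (rooted a m (r + s) S ∧ (isRoot S c ∧ (rootCount a j S ≡ᵇ suc r)))
      ≡ (rooted a j r S₁ ∧ (all inRight S₂ ∧ rooted c m′ s S₂))
    rooted-split r s chords = T-injective (rooted-split⇒ r s) (rooted-split⇐ r s chords)

module Base (a m : ℕ) where
  M = suc (suc m)

  base : Pair
  base = (a , a + M)

  isBase : Pair → Bool
  isBase (i , k) = (i ≡ᵇ a) ∧ (k ≡ᵇ a + M)

  isBase⇒≡base : ∀ x → T (isBase x) → x ≡ base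
  isBase⇒≡base (i , k) t = cong₂ _,_ (≡ᵇ⇒≡ i a (T-∧ˡ t)) (≡ᵇ⇒≡ k (a + M) (T-∧ʳ {i ≡ᵇ a} t))

  isBase-base : T (isBase base)
  isBase-base = T-∧⁺ (≡⇒≡ᵇ a a refl) (≡⇒≡ᵇ (a + M) (a + M) refl)

  base-IsChord : IsChord a M base
  base-IsChord = ≤-refl , subst (_≤ a + M) (+-comm a 2) (+-monoʳ-≤ a {2} {M} (s≤s (s≤s z≤n))) , ≤-refl

  ¬Crosses-base : ∀ y → T (isChord a M y) → ¬ Crosses base y
  ¬Crosses-base (i′ , k′) chord (inj₁ (_ , _ , a+M<k′)) =
    <-irrefl refl (<-≤-trans a+M<k′ (proj₂ (proj₂ (isChord⇒IsChord a M (i′ , k′) chord))))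
  ¬Crosses-base (i′ , k′) chord (inj₂ (i′<a , _)) =
    <-irrefl refl (<-≤-trans i′<a (proj₁ (isChord⇒IsChord a M (i′ , k′) chord)))

  base∈⇒rootCount≡2 : ∀ S → Chords a M S → base ∈ S → rootCount a M S ≡ 2
  base∈⇒rootCount≡2 S chords base∈S = trans (rootCount-inner a (suc m) S chords) (cong (λ z → suc (z + 1))
    (trans (∑<-cong (suc m) λ i i≤m → cong ind (Separates⇒¬isRoot S (a + suc i) base∈S (m<m+n a z<s , +-monoʳ-< a (s≤s i≤m))))
           (∑<-0 (suc m))))

  rootCount≡2⇒inner-¬isRoot : ∀ S → Chords a M S → rootCount a M S ≡ 2 → ∀ i → i < suc m → isRoot S (a + suc i) ≡ false
  rootCount≡2⇒inner-¬isRoot S chords #root≡2 i i≤m = ind≡0⇒false (∑<-≡0⇒≡0 (suc m) (λ i → ind (isRoot S (a + suc i)))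
    (+-cancelʳ-≡ 1 _ 0 (suc-injective (trans (sym (rootCount-inner a (suc m) S chords)) #root≡2))) i i≤m)

  farthest-from-a : ∀ S → Chords a M S → rootCount a M S ≡ 2 → (a , farthest a S) ∈ S
  farthest-from-a S chords #root≡2
    with (i , k) , ik∈S , (i<a+1 , a+1<k) ← ¬isRoot⇒Separates S (a + 1) (rootCount≡2⇒inner-¬isRoot S chords #root≡2 0 z<s)
    with farthest-∈ a S
  ... | inj₂ aK∈S = aK∈S
  ... | inj₁ K≡0  = ⊥-elim (<-irrefl refl (<-≤-trans (≤-<-trans z≤n a+1<k) (subst (k ≤_) K≡0 (≤-farthest a S k ak∈S))))
    where
    i≡a : i ≡ a
    i≡a = ≤-antisym (s≤s⁻¹ (subst (i <_) (+-comm a 1) i<a+1)) (proj₁ (isChord⇒IsChord a M (i , k) (All-lookup chords ik∈S)))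
    ak∈S : (a , k) ∈ S
    ak∈S = subst (λ i → (i , k) ∈ S) i≡a ik∈S

  -- If only the ends of the base are roots, the chord from a reaching farthest must be the base: otherwise its
  -- far end K is not a root, and a chord separating K either starts at a and reaches beyond K, or crosses (a , K).
  farthest-is-end : ∀ S → Chords a M S → NonCrossing S → rootCount a M S ≡ 2 → farthest a S ≡ a + M
  farthest-is-end S chords nc #root≡2 = [ (λ K<a+M → ⊥-elim (K-separated K<a+M)) , id ]′ (m≤n⇒m<n∨m≡n (proj₂ (proj₂ aK-chord)))
    where
    K = farthest a S
    aK∈S = farthest-from-a S chords #root≡2
    aK-chord = isChord⇒IsChord a M (a , K) (All-lookup chords aK∈S)
    j = K ∸ suc a
    a+1+j≡K : a + suc j ≡ K
    a+1+j≡K = trans (+-suc a j) (m+[n∸m]≡n (≤-trans (s≤s (n≤1+n a)) (proj₁ (proj₂ aK-chord))))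
    K-separated : K < a + M → ⊥
    K-separated K<a+M
      with (i′ , k′) , y∈S , (i′<K , K<k′) ← ¬isRoot⇒Separates S (a + suc j) (rootCount≡2⇒inner-¬isRoot S chords #root≡2 j
                                               (s≤s⁻¹ (+-cancelˡ-< a (suc j) M (subst (_< a + M) (sym a+1+j≡K) K<a+M))))
      with m≤n⇒m<n∨m≡n (proj₁ (isChord⇒IsChord a M (i′ , k′) (All-lookup chords y∈S)))
    ... | inj₂ a≡i′ = <-irrefl refl (<-≤-trans (subst (_< k′) a+1+j≡K K<k′)
                                               (≤-farthest a S k′ (subst (λ z → (z , k′) ∈ S) (sym a≡i′) y∈S)))
    ... | inj₁ a<i′ = nc aK∈S y∈S (inj₁ (a<i′ , subst (i′ <_) a+1+j≡K i′<K , subst (_< k′) a+1+j≡K K<k′))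

  rootCount≡2⇒base∈ : ∀ S → Chords a M S → NonCrossing S → rootCount a M S ≡ 2 → base ∈ S
  rootCount≡2⇒base∈ S chords nc #root≡2 =
    subst (λ z → (a , z) ∈ S) (farthest-is-end S chords nc #root≡2) (farthest-from-a S chords #root≡2)

  private
    split-base : ∀ S {x} → x ∈ S → x ≡ base ⊎ x ∈ filterᵇ (not ∘ isBase) S
    split-base S {x} x∈S with isBase x in base?
    ... | true  = inj₁ (isBase⇒≡base x (subst T (sym base?) tt))
    ... | false = inj₂ (∈-filterᵇ⁺ (not ∘ isBase) x∈S (subst (T ∘ not) (sym base?) tt))

  rooted-1 : ∀ S → Chords a M S → rooted a M 1 S ≡ (not (null (filterᵇ isBase S)) ∧ noncrossing (filterᵇ (not ∘ isBase) S))
  rooted-1 S chords = T-injective split join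
    where
    split : T (rooted a M 1 S) → T (not (null (filterᵇ isBase S)) ∧ noncrossing (filterᵇ (not ∘ isBase) S))
    split t = T-∧⁺ (nonnull (∈-filterᵇ⁺ isBase base∈S isBase-base))
                   (NonCrossing⇒noncrossing _ (NonCrossing-⊆ S _ (proj₁ ∘ ∈-filterᵇ⁻ (not ∘ isBase) S) nc))
      where
      nc = noncrossing⇒NonCrossing S (T-∧ˡ t)
      base∈S = rootCount≡2⇒base∈ S chords nc (≡ᵇ⇒≡ _ _ (T-∧ʳ {noncrossing S} t))
      nonnull : ∀ {x : Pair} {L} → x ∈ L → T (not (null L))
      nonnull (here _)  = tt
      nonnull (there _) = tt
    join : T (not (null (filterᵇ isBase S)) ∧ noncrossing (filterᵇ (not ∘ isBase) S)) → T (rooted a M 1 S)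
    join t = T-∧⁺ (NonCrossing⇒noncrossing S nc) (≡⇒≡ᵇ _ _ (base∈⇒rootCount≡2 S chords base∈S))
      where
      member : ∀ L → T (not (null L)) → ∃ λ (x : Pair) → x ∈ L
      member (x ∷ _) _ = x , here refl
      base∈S : base ∈ S
      base∈S with x , x∈ ← member (filterᵇ isBase S) (T-∧ˡ t) =
        let (x∈S , base-x) = ∈-filterᵇ⁻ isBase S x∈ in subst (_∈ S) (isBase⇒≡base x base-x) x∈S
      nc′ = noncrossing⇒NonCrossing _ (T-∧ʳ {not (null (filterᵇ isBase S))} t)
      nc : NonCrossing S
      nc {x} {y} x∈S y∈S with split-base S x∈S | split-base S y∈S
      ... | inj₁ refl | _         = ¬Crosses-base y (All-lookup chords y∈S)
      ... | inj₂ _    | inj₁ refl = ¬Crosses-base x (All-lookup chords x∈S) ∘ Crosses-sym x base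
      ... | inj₂ x∈′  | inj₂ y∈′  = nc′ x∈′ y∈′

  rooted-2+ : ∀ S r → Chords a M S → rooted a M (suc (suc r)) S ≡ (null (filterᵇ isBase S) ∧ rooted a M (suc (suc r)) (filterᵇ (not ∘ isBase) S))
  rooted-2+ S r chords = begin
      rooted a M (suc (suc r)) S
    ≡⟨ T-injective (λ t → T-∧⁺ (no-base t) t) (T-∧ʳ {all (not ∘ isBase) S}) ⟩
      all (not ∘ isBase) S ∧ rooted a M (suc (suc r)) S
    ≡⟨ all∧≡filterᵇ∧null (not ∘ isBase) (rooted a M (suc (suc r))) S ⟩
      rooted a M (suc (suc r)) (filterᵇ (not ∘ isBase) S) ∧ null (filterᵇ (not ∘ not ∘ isBase) S)
    ≡⟨ cong (λ L → rooted a M (suc (suc r)) (filterᵇ (not ∘ isBase) S) ∧ null L) (filterᵇ-≗ (not-involutive ∘ isBase) S) ⟩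
      rooted a M (suc (suc r)) (filterᵇ (not ∘ isBase) S) ∧ null (filterᵇ isBase S)
    ≡⟨ ∧-comm _ (null (filterᵇ isBase S)) ⟩
      null (filterᵇ isBase S) ∧ rooted a M (suc (suc r)) (filterᵇ (not ∘ isBase) S)
    ∎
    where
    open ≡-Reasoning
    no-base : T (rooted a M (suc (suc r)) S) → T (all (not ∘ isBase) S)
    no-base t = all⁻ (not ∘ isBase) (tabulate λ {x} x∈S → T-not⁺ λ base-x →
      2≢3+r (trans (sym (base∈⇒rootCount≡2 S chords (subst (_∈ S) (isBase⇒≡base x base-x) x∈S)))
                   (≡ᵇ⇒≡ _ _ (T-∧ʳ {noncrossing S} t))))
      where
      2≢3+r : 2 ≢ suc (suc (suc r))
      2≢3+r ()

-- Counting rooted dissections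

-- Chords are drawn from the pairs of numbers below N, so chords a m and #rooted a m are only the intended ones
-- when a + m < N.
module Counting (N : ℕ) where

  grid : List Pair
  grid = concatMap (λ i → map (λ j → (i , j)) (upTo N)) (upTo N)

  chords : ℕ → ℕ → List Pair
  chords a m = filterᵇ (isChord a m) grid

  #rooted : ℕ → ℕ → ℕ → ℕ
  #rooted a m r = count (rooted a m r) (chords a m)

  chords-Chords : ∀ a m → Chords a m (chords a m)
  chords-Chords a m = all-filter (T? ∘ isChord a m) grid

  module _ (a j m′ : ℕ) where
    open SplitAt a j m′

    chords-left : filterᵇ inLeft (chords a m) ≡ chords a j
    chords-left = trans (filterᵇ-∘ inLeft (isChord a m) grid) (filterᵇ-≗ same grid)
      where
      same : ∀ x → (isChord a m x ∧ inLeft x) ≡ isChord a j x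
      same (i , k) = T-injective
        (λ t → let (a≤i , i+2≤k , _) = isChord⇒IsChord a m (i , k) (T-∧ˡ t) in
               IsChord⇒isChord a j (i , k) (a≤i , i+2≤k , ≤ᵇ⇒≤ k c (T-∧ʳ {isChord a m (i , k)} t)))
        (λ t → let (a≤i , i+2≤k , k≤c) = isChord⇒IsChord a j (i , k) t in
               T-∧⁺ (IsChord⇒isChord a m (i , k) (a≤i , i+2≤k , ≤-trans k≤c (+-monoʳ-≤ a (m≤m+n j m′)))) (≤⇒≤ᵇ k≤c))

    chords-right : filterᵇ inRight (filterᵇ (not ∘ inLeft) (chords a m)) ≡ chords c m′
    chords-right = trans (cong (filterᵇ inRight) (filterᵇ-∘ (not ∘ inLeft) (isChord a m) grid))
                         (trans (filterᵇ-∘ inRight _ grid) (filterᵇ-≗ same grid))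
      where
      same : ∀ x → ((isChord a m x ∧ not (inLeft x)) ∧ inRight x) ≡ isChord c m′ x
      same (i , k) = T-injective
        (λ t → let t₁ = T-∧ˡ t
                   (_ , i+2≤k , k≤a+m) = isChord⇒IsChord a m (i , k) (T-∧ˡ t₁) in
               IsChord⇒isChord c m′ (i , k) (≤ᵇ⇒≤ c i (T-∧ʳ {isChord a m (i , k) ∧ not (inLeft (i , k))} t) , i+2≤k ,
                                              ≤-trans k≤a+m (≤-reflexive (sym (+-assoc a j m′)))))
        (λ t → let (c≤i , i+2≤k , k≤c+m′) = isChord⇒IsChord c m′ (i , k) t in
               T-∧⁺ (T-∧⁺ (IsChord⇒isChord a m (i , k) (≤-trans (m≤m+n a j) c≤i , i+2≤k , ≤-trans k≤c+m′ (≤-reflexive (+-assoc a j m′))))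
                          (T-not⁺ λ k≤c → <-irrefl refl (≤-trans (≤-trans (s≤s (s≤s c≤i)) i+2≤k) (≤-trans (≤ᵇ⇒≤ k c k≤c) (n≤1+n _)))))
                    (≤⇒≤ᵇ c≤i))

    #rooted-split : ∀ r s → count (λ S → rooted a m (r + s) S ∧ (isRoot S c ∧ (rootCount a j S ≡ᵇ suc r))) (chords a m)
                            ≡ #rooted a j r * #rooted c m′ s
    #rooted-split r s = begin
        count (λ S → rooted a m (r + s) S ∧ (isRoot S c ∧ (rootCount a j S ≡ᵇ suc r))) (chords a m)
      ≡⟨ count-cong (T ∘ isChord a m) (chords a m) (chords-Chords a m) (λ S chordsS → rooted-split S r s chordsS) ⟩
        count (λ S → rooted a j r (filterᵇ inLeft S) ∧ rightPart (filterᵇ (not ∘ inLeft) S)) (chords a m)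
      ≡⟨ count-product inLeft (rooted a j r) rightPart (chords a m) ⟩
        count (rooted a j r) (filterᵇ inLeft (chords a m)) * count rightPart L₂
      ≡⟨ cong₂ _*_ (cong (count (rooted a j r)) chords-left) #rightPart ⟩
        #rooted a j r * #rooted c m′ s
      ∎
      where
      open ≡-Reasoning
      rightPart = λ S₂ → all inRight S₂ ∧ rooted c m′ s S₂
      L₂ = filterᵇ (not ∘ inLeft) (chords a m)
      #rightPart : count rightPart L₂ ≡ #rooted c m′ s
      #rightPart = begin
          count rightPart L₂
        ≡⟨ count-≗ L₂ (all∧≡filterᵇ∧null inRight (rooted c m′ s)) ⟩
          count (λ S₂ → rooted c m′ s (filterᵇ inRight S₂) ∧ null (filterᵇ (not ∘ inRight) S₂)) L₂
        ≡⟨ count-product inRight (rooted c m′ s) null L₂ ⟩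
          count (rooted c m′ s) (filterᵇ inRight L₂) * count null (filterᵇ (not ∘ inRight) L₂)
        ≡⟨ cong₂ _*_ (cong (count (rooted c m′ s)) chords-right) (count-null (filterᵇ (not ∘ inRight) L₂)) ⟩
          #rooted c m′ s * 1
        ≡⟨ *-identityʳ _ ⟩
          #rooted c m′ s
        ∎

  -- Split a dissection at its (r+1)-st root vertex a + j.
  #rooted-convolution : ∀ a m r s → #rooted a m (r + s) ≡ ∑[ j < suc m ] (#rooted a j r * #rooted (a + j) (m ∸ j) s)
  #rooted-convolution a m r s =
    trans (count-sum (T ∘ isChord a m) (rooted a m (r + s)) splitsAt (suc m) (chords a m) (chords-Chords a m) unique)
          (∑<-cong (suc m) λ j j≤m → subst (λ M → count (λ S → rooted a M (r + s) S ∧ splitsAt j S) (chords a M)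
                                                 ≡ #rooted a j r * #rooted (a + j) (m ∸ j) s)
                                          (m+[n∸m]≡n (s≤s⁻¹ j≤m)) (#rooted-split a j (m ∸ j) r s))
    where
    splitsAt : ℕ → List Pair → Bool
    splitsAt j S = isRoot S (a + j) ∧ (rootCount a j S ≡ᵇ suc r)
    unique : ∀ S → Chords a m S → ind (rooted a m (r + s) S) ≡ ∑[ j < suc m ] ind (rooted a m (r + s) S ∧ splitsAt j S)
    unique S _ with rooted a m (r + s) S in rootedS
    ... | true  = sym (FirstHit.unique-hit (isRoot S ∘ (a +_)) (suc r) (suc m) (s≤s z≤n)
                        (≤-trans (s≤s (m≤m+n r s)) (≤-reflexive (sym (≡ᵇ⇒≡ _ _ (T-∧ʳ {noncrossing S} (subst T (sym rootedS) tt)))))))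
    ... | false = sym (∑<-0 (suc m))

  private
    grid≡cartesianProduct : ∀ (xs ys : List ℕ) → concatMap (λ i → map (λ j → (i , j)) ys) xs ≡ cartesianProduct xs ys
    grid≡cartesianProduct []       ys = refl
    grid≡cartesianProduct (x ∷ xs) ys = cong (map (x ,_) ys ++_) (grid≡cartesianProduct xs ys)

    filterᵇ-singleton : {A : Set} (p : A → Bool) {x : A} {xs : List A} → Unique xs → x ∈ xs →
                        (∀ y → T (p y) → y ≡ x) → T (p x) → filterᵇ p xs ≡ x ∷ []
    filterᵇ-singleton p {x} (x≢ ∷ _) (here refl) only px with p x
    ... | true = cong (x ∷_) (filter-none (T? ∘ p) (All.map (λ x≢y py → x≢y (sym (only _ py))) x≢))
    filterᵇ-singleton p {x} {y ∷ xs} (y≢ ∷ u) (there x∈xs) only px with p y in py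
    ... | true  = ⊥-elim (All-lookup y≢ x∈xs (only y (subst T (sym py) tt)))
    ... | false = filterᵇ-singleton p u x∈xs only px

    chords-Unique : ∀ a m → Unique (chords a m)
    chords-Unique a m = Unique.filter⁺ (T? ∘ isChord a m)
      (subst Unique (sym (grid≡cartesianProduct (upTo N) (upTo N))) (Unique.cartesianProduct⁺ (Unique.upTo⁺ N) (Unique.upTo⁺ N)))

  module _ (a m : ℕ) where
    open Base a m

    base-only : a + M < N → filterᵇ isBase (chords a M) ≡ base ∷ []
    base-only a+M<N = filterᵇ-singleton isBase (chords-Unique a M) base∈chords isBase⇒≡base isBase-base
      where
      base∈chords : base ∈ chords a M
      base∈chords = ∈-filterᵇ⁺ (isChord a M)
        (subst (base ∈_) (sym (grid≡cartesianProduct (upTo N) (upTo N)))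
               (∈-cartesianProduct⁺ (∈-upTo⁺ (≤-<-trans (m≤m+n a M) a+M<N)) (∈-upTo⁺ a+M<N)))
        (IsChord⇒isChord a M base base-IsChord)

    private
      L = chords a M
      L′ = filterᵇ (not ∘ isBase) L

      isInner : Pair → Bool
      isInner x = isChord a M x ∧ not (isBase x)

      L′-inner : All (T ∘ isInner) L′
      L′-inner = subst (All (T ∘ isInner)) (sym (filterᵇ-∘ (not ∘ isBase) (isChord a M) grid)) (all-filter (T? ∘ isInner) grid)

      inner⇒Chords : ∀ {S} → All (T ∘ isInner) S → Chords a M S
      inner⇒Chords = All.map (λ {x} → T-∧ˡ {isChord a M x})

      #inner : ℕ → ℕ
      #inner r = count (rooted a M r) L′

      #inner-never : ∀ r → (∀ S → All (T ∘ isInner) S → rooted a M r S ≡ false) → #inner r ≡ 0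
      #inner-never r never = trans (count-cong (T ∘ isInner) L′ L′-inner never) (count-false L′)

    #inner-by-root : count noncrossing L′ ≡ ∑[ r < suc M ] #inner r
    #inner-by-root = count-sum (T ∘ isInner) noncrossing (λ r S → rootCount a M S ≡ᵇ suc r) (suc M) L′ L′-inner partition
      where
      partition : ∀ S → All (T ∘ isInner) S → ind (noncrossing S) ≡ ∑[ r < suc M ] ind (noncrossing S ∧ (rootCount a M S ≡ᵇ suc r))
      partition S inner with noncrossing S
      ... | false = sym (∑<-0 (suc M))
      ... | true  = sym (subst (λ z → ∑[ r < suc M ] ind (z ≡ᵇ suc r) ≡ 1) (sym #root≡suc)
                              (∑<-ind-≡ᵇ (pred (rootCount a M S)) (suc M) (subst (_≤ suc M) #root≡suc (rootCount≤ a M S))))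
        where
        #root≡suc : rootCount a M S ≡ suc (pred (rootCount a M S))
        #root≡suc = sym (suc-pred (rootCount a M S) {{>-nonZero (≤-trans (s≤s z≤n) (2≤rootCount a (suc m) S (inner⇒Chords inner)))}})

    #inner-0 : #inner 0 ≡ 0
    #inner-0 = #inner-never 0 λ S inner → trans (cong (noncrossing S ∧_)
      (≡ᵇ-false λ #root≡1 → <-irrefl refl (subst (2 ≤_) #root≡1 (2≤rootCount a (suc m) S (inner⇒Chords inner)))))
      (∧-zeroʳ (noncrossing S))

    #inner-1 : #inner 1 ≡ 0
    #inner-1 = #inner-never 1 λ S inner → T-injective (λ t → T-not⁻ (T-∧ʳ {isChord a M base} (All-lookup inner
      (rootCount≡2⇒base∈ S (inner⇒Chords inner) (noncrossing⇒NonCrossing S (T-∧ˡ t)) (≡ᵇ⇒≡ _ _ (T-∧ʳ {noncrossing S} t)))))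
      isBase-base) λ ()

    #rooted≡#inner : ∀ i → #rooted a M (suc (suc i)) ≡ #inner (suc (suc i))
    #rooted≡#inner i = begin
      #rooted a M (suc (suc i))
        ≡⟨ count-cong (T ∘ isChord a M) L (chords-Chords a M) (λ S chordsS → rooted-2+ S i chordsS) ⟩
      count (λ S → null (filterᵇ isBase S) ∧ rooted a M (suc (suc i)) (filterᵇ (not ∘ isBase) S)) L
        ≡⟨ count-product isBase null (rooted a M (suc (suc i))) L ⟩
      count null (filterᵇ isBase L) * #inner (suc (suc i))
        ≡⟨ cong (_* #inner (suc (suc i))) (count-null (filterᵇ isBase L)) ⟩
      1 * #inner (suc (suc i))
        ≡⟨ *-identityˡ _ ⟩
      #inner (suc (suc i))
        ∎
      where open ≡-Reasoning

    -- Removing the base leaves an arbitrary dissection, sorted here by its number of roots (at least three).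
    #rooted-base : a + M < N → #rooted a M 1 ≡ ∑[ i < suc m ] #rooted a M (suc (suc i))
    #rooted-base a+M<N = begin
        #rooted a M 1
      ≡⟨ count-cong (T ∘ isChord a M) L (chords-Chords a M) rooted-1 ⟩
        count (λ S → not (null (filterᵇ isBase S)) ∧ noncrossing (filterᵇ (not ∘ isBase) S)) L
      ≡⟨ count-product isBase (not ∘ null) noncrossing L ⟩
        count (not ∘ null) (filterᵇ isBase L) * count noncrossing L′
      ≡⟨ cong (λ l → count (not ∘ null) l * count noncrossing L′) (base-only a+M<N) ⟩
        1 * count noncrossing L′
      ≡⟨ trans (*-identityˡ _) #inner-by-root ⟩
        #inner 0 + (#inner 1 + ∑[ i < suc m ] #inner (suc (suc i)))
      ≡⟨ cong₂ (λ u v → u + (v + ∑[ i < suc m ] #inner (suc (suc i)))) #inner-0 #inner-1 ⟩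
        ∑[ i < suc m ] #inner (suc (suc i))
      ≡⟨ ∑<-cong (suc m) (λ i _ → sym (#rooted≡#inner i)) ⟩
        ∑[ i < suc m ] #rooted a M (suc (suc i))
      ∎
      where open ≡-Reasoning

  chords-empty : ∀ a m → m ≤ 1 → chords a m ≡ []
  chords-empty a m m≤1 = filter-none (T? ∘ isChord a m) (All.universal (λ x chord → too-short x (isChord⇒IsChord a m x chord)) grid)
    where
    too-short : ∀ x → ¬ IsChord a m x
    too-short (i , k) (a≤i , i+2≤k , k≤a+m) =
      <-irrefl refl (≤-trans (≤-trans (s≤s (s≤s a≤i)) i+2≤k) (≤-trans k≤a+m (subst (a + m ≤_) (+-comm a 1) (+-monoʳ-≤ a m≤1))))

  #rooted-0-0 : ∀ a → #rooted a 0 0 ≡ 1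
  #rooted-0-0 a = cong (count (rooted a 0 0)) (chords-empty a 0 z≤n)

  #rooted-1-1 : ∀ a → #rooted a 1 1 ≡ 1
  #rooted-1-1 a = cong (count (rooted a 1 1)) (chords-empty a 1 ≤-refl)

  private
    #rooted-never : ∀ a m r → (∀ S → Chords a m S → rootCount a m S ≢ suc r) → #rooted a m r ≡ 0
    #rooted-never a m r ≢ = trans (count-cong (T ∘ isChord a m) (chords a m) (chords-Chords a m) never) (count-false (chords a m))
      where
      never : ∀ S → Chords a m S → rooted a m r S ≡ false
      never S chordsS = trans (cong (noncrossing S ∧_) (≡ᵇ-false (≢ S chordsS))) (∧-zeroʳ (noncrossing S))

  #rooted-vanish : ∀ a m r → m < r → #rooted a m r ≡ 0
  #rooted-vanish a m r m<r = #rooted-never a m r λ S _ #root≡ → <-irrefl refl (<-≤-trans (s≤s m<r) (subst (_≤ suc m) #root≡ (rootCount≤ a m S)))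

  #rooted-suc-0 : ∀ a m → #rooted a (suc m) 0 ≡ 0
  #rooted-suc-0 a m = #rooted-never a (suc m) 0 λ S chordsS #root≡1 → <-irrefl refl (subst (2 ≤_) #root≡1 (2≤rootCount a m S chordsS))

  -- Split at the first root vertex a + j after a: for j = 1 the left part is the side (a , a + 1); for j ≥ 2 its
  -- root part is just its base, and #rooted-base sorts it by the root part of what lies inside.
  #rooted-peel : ∀ a m e → a + suc m < N →
    #rooted a (suc m) (suc e) ≡ #rooted (suc a) m e + ∑[ i < m ] #rooted a (suc m) (suc (suc i) + e)
  #rooted-peel a m e a+m<N = begin
      #rooted a (suc m) (suc e)
    ≡⟨ #rooted-convolution a (suc m) 1 e ⟩
      #rooted a 0 1 * #rooted (a + 0) (suc m) e + (#rooted a 1 1 * #rooted (a + 1) m e + R)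
    ≡⟨ cong₂ (λ u v → u * #rooted (a + 0) (suc m) e + (v * #rooted (a + 1) m e + R)) (#rooted-vanish a 0 1 z<s) (#rooted-1-1 a) ⟩
      1 * #rooted (a + 1) m e + R
    ≡⟨ cong (_+ R) (trans (*-identityˡ _) (cong (λ z → #rooted z m e) (+-comm a 1))) ⟩
      #rooted (suc a) m e + R
    ≡⟨ cong (#rooted (suc a) m e +_) R≡ ⟩
      #rooted (suc a) m e + ∑[ i < m ] #rooted a (suc m) (suc (suc i) + e)
    ∎
    where
    open ≡-Reasoning
    W : ℕ → ℕ
    W j = #rooted (a + suc (suc j)) (m ∸ suc j) e
    R = ∑[ j < m ] (#rooted a (suc (suc j)) 1 * W j)
    expand : ∀ j → j < m → #rooted a (suc (suc j)) 1 * W j ≡ ∑[ i < m ] (#rooted a (suc (suc j)) (suc (suc i)) * W j)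
    expand j j<m = begin
        #rooted a (suc (suc j)) 1 * W j
      ≡⟨ cong (_* W j) (#rooted-base a j (≤-<-trans (+-monoʳ-≤ a (s≤s j<m)) a+m<N)) ⟩
        ∑[ i < suc j ] #rooted a (suc (suc j)) (suc (suc i)) * W j
      ≡⟨ ∑<-*ʳ (suc j) (W j) (λ i → #rooted a (suc (suc j)) (suc (suc i))) ⟨
        ∑[ i < suc j ] (#rooted a (suc (suc j)) (suc (suc i)) * W j)
      ≡⟨ ∑<-vanishing (suc j) (m ∸ suc j) _ (λ i j<i → cong (_* W j) (#rooted-vanish a (suc (suc j)) (suc (suc i)) (s≤s (s≤s j<i)))) ⟨
        ∑< (suc j + (m ∸ suc j)) (λ i → #rooted a (suc (suc j)) (suc (suc i)) * W j)
      ≡⟨ cong (λ z → ∑< z (λ i → #rooted a (suc (suc j)) (suc (suc i)) * W j)) (m+[n∸m]≡n j<m) ⟩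
        ∑[ i < m ] (#rooted a (suc (suc j)) (suc (suc i)) * W j)
      ∎
    collect : ∀ i → ∑[ j < m ] (#rooted a (suc (suc j)) (suc (suc i)) * W j) ≡ #rooted a (suc m) (suc (suc i) + e)
    collect i = sym (trans (#rooted-convolution a (suc m) (suc (suc i)) e)
      (cong₂ (λ u v → u * #rooted (a + 0) (suc m) e + (v * #rooted (a + 1) m e + ∑[ j < m ] (#rooted a (suc (suc j)) (suc (suc i)) * W j)))
             (#rooted-vanish a 0 (suc (suc i)) z<s) (#rooted-vanish a 1 (suc (suc i)) (s<s z<s))))
    R≡ : R ≡ ∑[ i < m ] #rooted a (suc m) (suc (suc i) + e)
    R≡ = trans (∑<-cong m expand) (trans (∑<-comm m m _) (∑<-cong m (λ i _ → collect i)))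

  #rooted-recurrence : ∀ a n e → a + (n + suc e) < N →
    #rooted a (n + suc e) (suc e) ≡ #rooted (suc a) (n + e) e + ∑[ i < n ] #rooted a (n + suc e) (suc (suc e) + i)
  #rooted-recurrence a n e a+m<N rewrite +-suc n e = begin
      #rooted a (suc (n + e)) (suc e)
    ≡⟨ #rooted-peel a (n + e) e a+m<N ⟩
      #rooted (suc a) (n + e) e + ∑[ i < n + e ] #rooted a (suc (n + e)) (suc (suc i) + e)
    ≡⟨ cong (#rooted (suc a) (n + e) e +_) (∑<-vanishing n e _ (λ i n≤i → #rooted-vanish a (suc (n + e)) (suc (suc i) + e) (s≤s (s≤s (+-monoˡ-≤ e n≤i))))) ⟩
      #rooted (suc a) (n + e) e + ∑[ i < n ] #rooted a (suc (n + e)) (suc (suc i) + e)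
    ≡⟨ cong (#rooted (suc a) (n + e) e +_) (∑<-cong n (λ i _ → cong (#rooted a (suc (n + e))) (swap i e))) ⟩
      #rooted (suc a) (n + e) e + ∑[ i < n ] #rooted a (suc (n + e)) (suc (suc e) + i)
    ∎
    where
    open ≡-Reasoning
    swap : ∀ i e → suc (suc i) + e ≡ suc (suc e) + i
    swap = solve-∀

-- Dissections of the polygon with a fixed side

length-filterᵇ-applyUpTo : ∀ n (q : ℕ → Bool) (f : ℕ → ℕ) → length (filterᵇ q (applyUpTo f n)) ≡ ∑[ i < n ] ind (q (f i))
length-filterᵇ-applyUpTo zero    q f = refl
length-filterᵇ-applyUpTo (suc n) q f with q (f 0)
... | true  = cong suc (length-filterᵇ-applyUpTo n q (f ∘ suc))
... | false = length-filterᵇ-applyUpTo n q (f ∘ suc)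

fixedPartSize≡rootCount : ∀ m S → fixedPartSize (suc m) S ≡ rootCount 0 m S
fixedPartSize≡rootCount m S = length-filterᵇ-applyUpTo (suc m) (isRoot S) (λ i → i)

-- The diagonals of the polygon 0 … M are its chords other than the fixed side, which is the base (0 , M).
isDiagonal≡isChord∧not-isBase : ∀ m x → (isChord 0 (suc (suc m)) x ∧ not (Base.isBase 0 m x)) ≡ isDiagonal (suc (suc (suc m))) x
isDiagonal≡isChord∧not-isBase m (i , j) = T-injective diagonal chord
  where
  M = suc (suc m)
  diagonal : T (isChord 0 M (i , j) ∧ not (Base.isBase 0 m (i , j))) → T (isDiagonal (suc M) (i , j))
  diagonal t = T-∧⁺ (<⇒<ᵇ (≤-trans (n≤1+n (suc i)) i+2≤j)) (T-∧⁺ (<⇒<ᵇ 2≤j∸i) (T-∧⁺ (<⇒<ᵇ (s≤s j≤M)) (T-∧ʳ {isChord 0 M (i , j)} t)))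
    where
    chord = isChord⇒IsChord 0 M (i , j) (T-∧ˡ t)
    i+2≤j = proj₁ (proj₂ chord)
    j≤M = proj₂ (proj₂ chord)
    2≤j∸i : 1 < j ∸ i
    2≤j∸i = subst (_≤ j ∸ i) (m+n∸n≡m 2 i) (∸-monoˡ-≤ i i+2≤j)
  chord : T (isDiagonal (suc M) (i , j)) → T (isChord 0 M (i , j) ∧ not (Base.isBase 0 m (i , j)))
  chord t = T-∧⁺ (IsChord⇒isChord 0 M (i , j) (z≤n , i+2≤j , s≤s⁻¹ (<ᵇ⇒< j (suc M) (T-∧ˡ t₃)))) (T-∧ʳ {j <ᵇ suc M} t₃)
    where
    i<j = <ᵇ⇒< i j (T-∧ˡ t)
    t₂ = T-∧ʳ {i <ᵇ j} t
    1<j∸i = <ᵇ⇒< 1 (j ∸ i) (T-∧ˡ t₂)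
    t₃ = T-∧ʳ {1 <ᵇ (j ∸ i)} t₂
    i+2≤j : 2 + i ≤ j
    i+2≤j = subst (_≤ j) (+-comm i 2) (subst (i + 2 ≤_) (m+[n∸m]≡n (<⇒≤ i<j)) (+-monoʳ-≤ i 1<j∸i))

-- As d ≥ 2, the chord (0 , B), i.e. the fixed side, never occurs in a dissection with d + 1 roots.
y≡#rooted : ∀ B d → 2 ≤ d → d ≤ B →
  length (filterᵇ (λ ds → fixedPartSize (suc B) ds ≡ᵇ (d + 1)) (dissections (suc B))) ≡ Counting.#rooted (suc B) 0 B d
y≡#rooted _             zero          ()        _
y≡#rooted _             (suc zero)    (s≤s ())  _
y≡#rooted zero          (suc (suc e)) _         ()
y≡#rooted (suc zero)    (suc (suc e)) _         (s≤s ())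
y≡#rooted (suc (suc m)) (suc (suc e)) _         _ = begin
    length (filterᵇ hasSize (filterᵇ noncrossing (sublists D)))
  ≡⟨ cong length (filterᵇ-∘ hasSize noncrossing (sublists D)) ⟩
    count (λ S → noncrossing S ∧ hasSize S) D
  ≡⟨ count-≗ D (λ S → cong (noncrossing S ∧_) (cong₂ _≡ᵇ_ (fixedPartSize≡rootCount M S) (+-comm d 1))) ⟩
    count (rooted 0 M d) D
  ≡⟨ cong (count (rooted 0 M d)) D≡ ⟩
    count (rooted 0 M d) (filterᵇ (not ∘ isBase) L)
  ≡⟨ *-identityˡ _ ⟨
    1 * count (rooted 0 M d) (filterᵇ (not ∘ isBase) L)
  ≡⟨ cong (_* count (rooted 0 M d) (filterᵇ (not ∘ isBase) L)) (count-null (filterᵇ isBase L)) ⟨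
    count null (filterᵇ isBase L) * count (rooted 0 M d) (filterᵇ (not ∘ isBase) L)
  ≡⟨ count-product isBase null (rooted 0 M d) L ⟨
    count (λ S → null (filterᵇ isBase S) ∧ rooted 0 M d (filterᵇ (not ∘ isBase) S)) L
  ≡⟨ count-cong (T ∘ isChord 0 M) L (chords-Chords 0 M) (λ S chordsS → rooted-2+ S e chordsS) ⟨
    #rooted 0 M d
  ∎
  where
  open ≡-Reasoning
  open Counting (suc (suc (suc m)))
  open Base 0 m
  d = suc (suc e)
  hasSize = λ ds → fixedPartSize (suc M) ds ≡ᵇ (d + 1)
  D = diagonals (suc M)
  L = chords 0 M
  D≡ : D ≡ filterᵇ (not ∘ isBase) L
  D≡ = sym (trans (filterᵇ-∘ (not ∘ isBase) (isChord 0 M) grid) (filterᵇ-≗ (isDiagonal≡isChord∧not-isBase m) grid))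

corollary5 : (d : ℕ) → 2 ≤ d → (n : ℕ) → 1 ≤ n →
    (n + d) * y d n ≡ d * rhsSum d n
corollary5 d 2≤d (suc p) _ = begin
  (suc p + d) * y d (suc p)                            ≡⟨ cong ((suc p + d) *_) y≡ ⟩
  (suc p + d) * Counting.#rooted N 0 (suc p + d) d     ≡⟨ solution (suc p) d 0 ≤-refl ⟩
  rhs d (suc p)                                        ≡⟨ rhs≡d*rhsSum d p ⟩
  d * rhsSum d (suc p)                                 ∎
  where
  open ≡-Reasoning
  N = suc (suc p + d)
  open RecurrenceSolution N (Counting.#rooted N) (Counting.#rooted-0-0 N) (Counting.#rooted-suc-0 N) (Counting.#rooted-recurrence N)
  y≡ : y d (suc p) ≡ Counting.#rooted N 0 (suc p + d) d
  y≡ = subst (λ X → length (filterᵇ (λ ds → fixedPartSize X ds ≡ᵇ (d + 1)) (dissections X)) ≡ Counting.#rooted N 0 (suc p + d) d)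
             (+-comm 1 (suc p + d)) (y≡#rooted (suc p + d) d 2≤d (m≤n+m d (suc p)))
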